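{- For all integers $n,m\geq 0$, $$B_n^{(m+1)}=\sum_{\lambda\vdash n}\prod_{j\ge1}h_{m_j(\lambda)}\big(B_j^{(m)}\big),$$ where $m_j(\lambda)$ is the number of parts of $\lambda$ equal to $j$ and $h_k(B_j^{(m)})$ denotes plethysm.
   Context: Let $\Lambda$ be the ring of symmetric functions over $\mathbb{Q}$ in variables $X=(x_1,x_2,\ldots)$, completed with respect to degree. Write $h_n$ for complete homogeneous and $p_k$ for power sum symmetric functions. Plethysm: for a formal power series $A$ in the $x_i$ and auxiliary commuting variables (e.g. $t$), $p_k(A)$ is obtained from $A$ by replacing every variable by its $k$-th power, and for $F\in\Lambda$, $F(A)$ is obtained by writing $F$ in terms of the $p_k$ and substituting $p_k\mapsto p_k(A)$ (used only when $A$ has zero constant term, or $F$ is a polynomial). The alphabet $tX$ means $(tx_1,tx_2,\ldots)$, so $p_k(tX)=t^kp_k(X)$. Let $\Omega(X)=\sum_{n\ge0}h_n(X)$ and $\Omega_0(X)=\Omega(X)-1$. Define $\Omega_0^{(0)}(X)=h_1(X)$ and $\Omega_0^{(m+1)}(X)=\Omega_0(\Omega_0^{(m)}(X))$. The higher order Bell symmetric functions $B_n^{(m)}$ are defined by $\Omega(\Omega_0^{(m)}(tX))=\sum_{n\ge0}B_n^{(m)}(X)t^n$. -}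

module Defs where

-- Symmetric functions over ℚ, represented in the power-sum basis
-- (Λ_ℚ = ℚ[p₁,p₂,…], as the paper's plethysm is defined via the p_k).

open import Data.Nat as ℕ using (ℕ; zero; suc; _∸_; _≤ᵇ_; _≡ᵇ_; _⊓_)
open import Data.Nat.DivMod using (_%_; _/_)
open import Data.Integer using (+_)
open import Data.Rational as ℚ using (ℚ; 0ℚ; 1ℚ)
open import Data.List using (List; []; _∷_; map; foldr; concatMap; upTo; _++_; zipWith; length; filter)
open import Data.List.Properties using (≡-dec)
open import Data.Bool using (Bool; true; false; if_then_else_)
open import Data.Product using (_×_; _,_)
open import Relation.Nullary.Decidable using (does)
open import Relation.Binary.PropositionalEquality using (_≡_)

-- A power-sum monomial p_λ is a list of parts, kept in weakly decreasing order.
Mon : Set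
Mon = List ℕ

Sym : Set
Sym = List (ℚ × Mon)

insertD : ℕ → Mon → Mon
insertD a [] = a ∷ []
insertD a (b ∷ bs) = if b ≤ᵇ a then a ∷ b ∷ bs else b ∷ insertD a bs

mulMon : Mon → Mon → Mon
mulMon λ' μ = foldr insertD μ λ'

0S : Sym
0S = []

1S : Sym
1S = (1ℚ , []) ∷ []

pS : ℕ → Sym
pS k = (1ℚ , k ∷ []) ∷ []

_+S_ : Sym → Sym → Sym
F +S G = F ++ G

scale : ℚ → Sym → Sym
scale c F = map (λ { (d , m) → (c ℚ.* d , m) }) F

_*S_ : Sym → Sym → Sym
F *S G = concatMap (λ { (c , m) → map (λ { (d , n) → (c ℚ.* d , mulMon m n) }) G }) F

sumS : List Sym → Sym
sumS = foldr _+S_ 0S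

prodS : List Sym → Sym
prodS = foldr _*S_ 1S

coeff : Sym → Mon → ℚ
coeff [] μ = 0ℚ
coeff ((c , m) ∷ F) μ = if does (≡-dec ℕ._≟_ m μ) then c ℚ.+ coeff F μ else coeff F μ

_≈S_ : Sym → Sym → Set
F ≈S G = ∀ μ → coeff F μ ≡ coeff G μ

-- complete homogeneous h_n via Newton: n h_n = Σ_{i=1}^n p_i h_{n-i}
-- hsRev n = [h_n, h_{n-1}, …, h_0]
hsRev : ℕ → List Sym
hsRev zero = 1S ∷ []
hsRev (suc n) =
  scale ((+ 1) ℚ./ suc n)
        (sumS (zipWith (λ i h → pS (suc i) *S h) (upTo (suc n)) (hsRev n)))
  ∷ hsRev n

h : ℕ → Sym
h n with hsRev n
... | [] = 0S
... | x ∷ _ = x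

-- p_k(F): replace p_i by p_{ik}
adams : ℕ → Sym → Sym
adams k F = map (λ { (c , m) → (c , map (k ℕ.*_) m) }) F

pleth : Sym → Sym → Sym
pleth F G = sumS (map (λ { (c , m) → scale c (prodS (map (λ i → adams i G) m)) }) F)

-- Graded series: component n is the homogeneous part of degree n.
-- Since Ω(Ω₀^{(m)}(tX)) is homogeneous in the sense that the coefficient
-- of t^n is the degree-n part of Ω(Ω₀^{(m)}(X)), we work with degree components.
Series : Set
Series = ℕ → Sym

mulSer : Series → Series → Series
mulSer F G n = sumS (map (λ i → F i *S G (n ∸ i)) (upTo (suc n)))

oneSer : Series
oneSer zero = 1S
oneSer (suc _) = 0S

adamsSer : ℕ → Series → Series
adamsSer zero G n = 0S
adamsSer (suc k) G n = if (n % suc k) ≡ᵇ 0 then adams (suc k) (G (n / suc k)) else 0S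

plethSer : Sym → Series → Series
plethSer F G n =
  sumS (map (λ { (c , m) → scale c (foldr mulSer oneSer (map (λ i → adamsSer i G) m) n) }) F)

-- Ω(G) = Σ_{k≥0} h_k(G) and Ω₀(G) = Σ_{k≥1} h_k(G), for G with zero constant term
-- (h_k(G) has no component below degree k, so degree n only needs k ≤ n).
ΩSer : Series → Series
ΩSer G n = sumS (map (λ k → plethSer (h k) G n) (upTo (suc n)))

Ω₀Ser : Series → Series
Ω₀Ser G n = sumS (map (λ k → plethSer (h (suc k)) G n) (upTo n))

-- Ω₀^{(0)} = h₁
h1Ser : Series
h1Ser n = if n ≡ᵇ 1 then h 1 else 0S

Ω₀iter : ℕ → Series
Ω₀iter zero = h1Ser
Ω₀iter (suc m) = Ω₀Ser (Ω₀iter m)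

-- B_n^{(m)} = coefficient of t^n in Ω(Ω₀^{(m)}(tX))
B : ℕ → ℕ → Sym
B m n = ΩSer (Ω₀iter m) n

-- Partitions of n as weakly decreasing lists of positive parts.
-- partsB fuel n mx = partitions of n with all parts ≤ mx.
partsB : ℕ → ℕ → ℕ → List (List ℕ)
partsB _ zero _ = [] ∷ []
partsB zero (suc _) _ = []
partsB (suc f) n@(suc _) mx =
  concatMap (λ i → map (suc i ∷_) (partsB f (n ∸ suc i) (suc i))) (upTo (n ⊓ mx))

partitions : ℕ → List (List ℕ)
partitions n = partsB n n n

mult : ℕ → List ℕ → ℕ
mult j λ' = length (filter (λ a → a ℕ.≟ j) λ')

{-# OPTIONS --safe #-}
module Submission where

-- Newton's identity k·hₖ = Σᵢ pᵢ hₖ₋ᵢ says that Σₖ hₖ[F] uᵏ, a power series in an auxiliary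
-- variable u, has logarithmic derivative Σᵢ pᵢ₊₁[F] uⁱ. Because pᵢ[F + G] = pᵢ[F] + pᵢ[G] and a
-- power series is determined by its constant term and its logarithmic derivative, Ω[F] = Σₖ hₖ[F]
-- is exponential, Ω[F + G] = Ω[F] Ω[G] for F, G without constant term, and hₖ[x tʲ] = hₖ[x] tᵏʲ.
-- In positive degree j the coefficient of Ω₀^{(m+1)} = Ω₀[Ω₀^{(m)}] is B_j^{(m)}, so up to degree n
-- Ω[Ω₀^{(m+1)}] = ∏_{j ≤ n} Ω[B_j^{(m)} tʲ] = ∏_{j ≤ n} Σₗ hₗ[B_j^{(m)}] tˡʲ, and collecting the
-- coefficient of tⁿ one part size at a time gives the sum over partitions of n.
-- The algebra laws for lists of terms c·p_μ hold only up to reordering the parts of μ; since every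
-- construction keeps the parts in decreasing order, this suffices for coefficientwise equality.

open import Level using (0ℓ)
open import Algebra.Bundles using (CommutativeMonoid; CommutativeSemiring)
open import Data.Nat using (ℕ; suc)
open import Data.List using (List; map; upTo)
open import Data.Rational as ℚ using (ℚ; 0ℚ; 1ℚ)
import Data.Rational.Properties as ℚ
open import Defs using (Sym; 0S; B; _≈S_; sumS; prodS; pleth; h; mult; partitions; ΩSer; Ω₀Ser; Ω₀iter)

module ℚFromℕ where

  open import Data.Integer as ℤ using (+_)
  open import Data.Integer.Properties using (*-identityʳ)
  open import Data.Rational using (mkℚ; _/_; 1/_; _+_; _*_)
  open import Data.Rational.Properties using (/-cong; ↥p/↧p≡p; *-inverseʳ)
  open import Data.Nat.Divisibility using (∣1⇒≡1)
  open import Data.Product using (_,_)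
  open import Relation.Binary.PropositionalEquality using (_≡_; refl; cong; trans)

  -- mkℚ stores the denominator minus one.
  fromℕ : ℕ → ℚ
  fromℕ k = mkℚ (+ k) 0 (λ (_ , i∣1) → ∣1⇒≡1 i∣1)

  1+fromℕ : ∀ k → 1ℚ + fromℕ k ≡ fromℕ (suc k)
  1+fromℕ k = trans (/-cong (cong (ℤ._+_ (+ 1)) (*-identityʳ (+ k))) refl) (↥p/↧p≡p (fromℕ (suc k)))

  fromℕ*1/suc : ∀ n → fromℕ (suc n) * (+ 1 / suc n) ≡ 1ℚ
  fromℕ*1/suc n = trans (cong (fromℕ (suc n) *_) (↥p/↧p≡p (1/ fromℕ (suc n)))) (*-inverseʳ (fromℕ (suc n)))

module IndexedSum (M : CommutativeMonoid 0ℓ 0ℓ) where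

  open import Data.Nat as ℕ using (ℕ; zero; suc; _∸_; _<_; _≤_; z≤n; s≤s)
  open import Data.Nat.Properties
    using (suc-injective; ≤-pred; m≤m+n; m+[n∸m]≡n; +-monoʳ-<; +-∸-assoc; n∸n≡0)
  open import Data.List using (foldr; map; upTo; applyUpTo)
  open import Function using (_∘_)
  open import Relation.Binary.PropositionalEquality as ≡ using (_≡_; _≢_)
  open CommutativeMonoid M renaming
    (_∙_ to _+_; ε to 0#; ∙-cong to +-cong; ∙-congˡ to +-congˡ; identityˡ to +-identityˡ; identityʳ to +-identityʳ)
  open import Algebra.Properties.CommutativeSemigroup commutativeSemigroup using (interchange)
  open import Relation.Binary.Reasoning.Setoid setoid

  ∑ : ℕ → (ℕ → Carrier) → Carrier
  ∑ zero    f = 0#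
  ∑ (suc n) f = f 0 + ∑ n (λ i → f (suc i))

  syntax ∑ n (λ i → e) = ∑[ i < n ] e

  ∑-upTo : ∀ n (f : ℕ → Carrier) → foldr _+_ 0# (map f (upTo n)) ≡ ∑ n f
  ∑-upTo n f = go n (λ i → i)
    where
    go : ∀ n (g : ℕ → ℕ) → foldr _+_ 0# (map f (applyUpTo g n)) ≡ ∑[ i < n ] f (g i)
    go zero    g = ≡.refl
    go (suc n) g = ≡.cong (_+_ (f (g 0))) (go n (λ i → g (suc i)))

  ∑-cong : ∀ n {f g : ℕ → Carrier} → (∀ i → i < n → f i ≈ g i) → ∑ n f ≈ ∑ n g
  ∑-cong zero    f≈g = refl
  ∑-cong (suc n) f≈g = +-cong (f≈g 0 (s≤s z≤n)) (∑-cong n (λ i i<n → f≈g (suc i) (s≤s i<n)))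

  ∑-congᵖ : ∀ n {f g : ℕ → Carrier} → (∀ i → f i ≈ g i) → ∑ n f ≈ ∑ n g
  ∑-congᵖ n f≈g = ∑-cong n (λ i _ → f≈g i)

  ∑-zero : ∀ n {f : ℕ → Carrier} → (∀ i → i < n → f i ≈ 0#) → ∑ n f ≈ 0#
  ∑-zero zero    f≈0 = refl
  ∑-zero (suc n) f≈0 = trans (+-cong (f≈0 0 (s≤s z≤n)) (∑-zero n (λ i i<n → f≈0 (suc i) (s≤s i<n)))) (+-identityˡ 0#)

  ∑-distrib-+ : ∀ n (f g : ℕ → Carrier) → ∑[ i < n ] (f i + g i) ≈ ∑ n f + ∑ n g
  ∑-distrib-+ zero    f g = sym (+-identityˡ 0#)
  ∑-distrib-+ (suc n) f g = trans (+-congˡ (∑-distrib-+ n _ _)) (interchange _ _ _ _)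

  ∑-homo : ∀ (φ : Carrier → Carrier) → φ 0# ≈ 0# → (∀ x y → φ (x + y) ≈ φ x + φ y) →
           ∀ n f → φ (∑ n f) ≈ ∑[ i < n ] φ (f i)
  ∑-homo φ φ-0 φ-+ zero    f = φ-0
  ∑-homo φ φ-0 φ-+ (suc n) f = trans (φ-+ _ _) (+-congˡ (∑-homo φ φ-0 φ-+ n _))

  ∑-init-last : ∀ n (f : ℕ → Carrier) → ∑ (suc n) f ≈ ∑ n f + f n
  ∑-init-last zero    f = trans (+-identityʳ _) (sym (+-identityˡ _))
  ∑-init-last (suc n) f = trans (+-congˡ (∑-init-last n _)) (sym (assoc _ _ _))

  ∑-split : ∀ m n (f : ℕ → Carrier) → ∑ (m ℕ.+ n) f ≈ ∑ m f + ∑[ i < n ] f (m ℕ.+ i)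
  ∑-split zero    n f = sym (+-identityˡ _)
  ∑-split (suc m) n f = trans (+-congˡ (∑-split m n _)) (sym (assoc _ _ _))

  ∑-vanishing-tail : ∀ m n (f : ℕ → Carrier) → m ≤ n →
                     (∀ i → m ≤ i → i < n → f i ≈ 0#) → ∑ n f ≈ ∑ m f
  ∑-vanishing-tail m n f m≤n tail≈0 = begin
    ∑ n f                                    ≡⟨ ≡.cong (λ k → ∑ k f) (m+[n∸m]≡n m≤n) ⟨
    ∑ (m ℕ.+ (n ∸ m)) f                      ≈⟨ ∑-split m (n ∸ m) f ⟩
    ∑ m f + ∑[ i < n ∸ m ] f (m ℕ.+ i)       ≈⟨ +-congˡ (∑-zero (n ∸ m) tail′) ⟩
    ∑ m f + 0#                               ≈⟨ +-identityʳ _ ⟩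
    ∑ m f                                    ∎
    where
    tail′ : ∀ i → i < n ∸ m → f (m ℕ.+ i) ≈ 0#
    tail′ i i<n∸m = tail≈0 (m ℕ.+ i) (m≤m+n m i)
      (≡.subst (m ℕ.+ i <_) (m+[n∸m]≡n m≤n) (+-monoʳ-< m i<n∸m))

  ∑-single : ∀ n k (f : ℕ → Carrier) → k < n → (∀ i → i < n → i ≢ k → f i ≈ 0#) → ∑ n f ≈ f k
  ∑-single (suc n) zero    f _ others≈0 =
    trans (+-congˡ (∑-zero n (λ i i<n → others≈0 (suc i) (s≤s i<n) (λ ())))) (+-identityʳ _)
  ∑-single (suc n) (suc k) f (s≤s k<n) others≈0 =
    trans (+-cong (others≈0 0 (s≤s z≤n) (λ ()))
                  (∑-single n k _ k<n (λ i i<n i≢k → others≈0 (suc i) (s≤s i<n) (i≢k ∘ suc-injective))))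
          (+-identityˡ _)

  ∑-comm : ∀ m n (f : ℕ → ℕ → Carrier) → ∑[ i < m ] ∑[ j < n ] f i j ≈ ∑[ j < n ] ∑[ i < m ] f i j
  ∑-comm zero    n f = sym (∑-zero n (λ _ _ → refl))
  ∑-comm (suc m) n f = trans (+-congˡ (∑-comm m n _)) (sym (∑-distrib-+ n _ _))

  ∑-reverse : ∀ n (f : ℕ → Carrier) → ∑ (suc n) f ≈ ∑[ i < suc n ] f (n ∸ i)
  ∑-reverse zero    f = refl
  ∑-reverse (suc n) f = begin
    f 0 + ∑[ i < suc n ] f (suc i)              ≈⟨ +-congˡ (∑-reverse n (λ i → f (suc i))) ⟩
    f 0 + ∑[ i < suc n ] f (suc (n ∸ i))        ≈⟨ comm _ _ ⟩
    ∑[ i < suc n ] f (suc (n ∸ i)) + f 0        ≈⟨ +-cong (∑-cong (suc n) shift) (reflexive (≡.cong f (n∸n≡0 n))) ⟨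
    ∑[ i < suc n ] f (suc n ∸ i) + f (n ∸ n)    ≈⟨ ∑-init-last (suc n) (λ i → f (suc n ∸ i)) ⟨
    ∑[ i < suc (suc n) ] f (suc n ∸ i)          ∎
    where
    shift : ∀ i → i < suc n → f (suc n ∸ i) ≈ f (suc (n ∸ i))
    shift i i≤n = reflexive (≡.cong f (+-∸-assoc 1 (≤-pred i≤n)))

  ∑-antidiagonal : ∀ n (f : ℕ → ℕ → Carrier) →
                   ∑[ k < suc n ] ∑[ i < suc k ] f i (k ∸ i) ≈ ∑[ i < suc n ] ∑[ j < suc (n ∸ i) ] f i j
  ∑-antidiagonal zero    f = refl
  ∑-antidiagonal (suc n) f = begin
    ∑[ k < suc (suc n) ] (f 0 k + ∑[ i < k ] f (suc i) (k ∸ suc i))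
      ≈⟨ ∑-distrib-+ (suc (suc n)) (f 0) (λ k → ∑[ i < k ] f (suc i) (k ∸ suc i)) ⟩
    ∑[ k < suc (suc n) ] f 0 k + (0# + ∑[ k < suc n ] ∑[ i < suc k ] f (suc i) (k ∸ i))
      ≈⟨ +-congˡ (trans (+-identityˡ _) (∑-antidiagonal n (λ i → f (suc i)))) ⟩
    ∑[ j < suc (suc n) ] f 0 j + ∑[ i < suc n ] ∑[ j < suc (n ∸ i) ] f (suc i) j
      ∎

record ℚAlgebra : Set₁ where
  field
    commutativeSemiring : CommutativeSemiring 0ℓ 0ℓ
  open CommutativeSemiring commutativeSemiring public
  infixr 8 _·_
  field
    _·_        : ℚ → Carrier → Carrier
    ·-congˡ    : ∀ c {x y} → x ≈ y → c · x ≈ c · y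
    ·-assoc    : ∀ c d x → (c ℚ.* d) · x ≈ c · (d · x)
    ·-identity : ∀ x → 1ℚ · x ≈ x
    ·-zeroˡ    : ∀ x → 0ℚ · x ≈ 0#
    ·-distribˡ : ∀ c x y → c · (x + y) ≈ c · x + c · y
    ·-distribʳ : ∀ c d x → (c ℚ.+ d) · x ≈ c · x + d · x
    ·-*-assoc  : ∀ c x y → (c · x) * y ≈ c · (x * y)

module ℚAlgebraProperties (A : ℚAlgebra) where

  open import Data.Nat using (ℕ; zero; suc)
  open import Data.Integer using (+_)
  open import Data.Rational using (_/_)
  open import Relation.Binary.PropositionalEquality as ≡ using ()
  import Relation.Binary.Reasoning.Setoid as SetoidReasoning
  open ℚFromℕ

  open ℚAlgebra A public
  open import Algebra.Properties.Semiring.Mult semiring public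
    using (_×_; ×-congʳ; ×-homo-+; ×-assoc-*; ×-comm-*)
  open import Algebra.Properties.CommutativeMonoid.Mult +-commutativeMonoid using (×-distrib-+)
  open IndexedSum +-commutativeMonoid public
  private
    module Product = IndexedSum *-commutativeMonoid
  open Product public using ()
    renaming (∑-upTo to ∏-upTo; ∑-cong to ∏-cong; ∑-zero to ∏-one; ∑-distrib-+ to ∏-distrib-*; ∑-single to ∏-single)

  ∏ : ℕ → (ℕ → Carrier) → Carrier
  ∏ = Product.∑
  module ≈-Reasoning = SetoidReasoning setoid
  open ≈-Reasoning

  ·-zeroʳ : ∀ c → c · 0# ≈ 0#
  ·-zeroʳ c = begin
    c · 0#        ≈⟨ ·-congˡ c (zeroˡ 0#) ⟨
    c · (0# * 0#) ≈⟨ ·-*-assoc c 0# 0# ⟨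
    c · 0# * 0#   ≈⟨ zeroʳ _ ⟩
    0#            ∎

  *-·-comm : ∀ c x y → x * (c · y) ≈ c · (x * y)
  *-·-comm c x y = trans (*-comm x (c · y)) (trans (·-*-assoc c y x) (·-congˡ c (*-comm y x)))

  ·-*-distrib : ∀ c d x y → (c ℚ.* d) · (x * y) ≈ (c · x) * (d · y)
  ·-*-distrib c d x y = begin
    (c ℚ.* d) · (x * y) ≈⟨ ·-assoc c d (x * y) ⟩
    c · d · (x * y)     ≈⟨ ·-congˡ c (*-·-comm d x y) ⟨
    c · (x * d · y)     ≈⟨ ·-*-assoc c x (d · y) ⟨
    c · x * d · y       ∎

  ×-zeroʳ : ∀ k → k × 0# ≈ 0#
  ×-zeroʳ zero    = refl
  ×-zeroʳ (suc k) = trans (+-identityˡ _) (×-zeroʳ k)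

  *-distribˡ-∑ : ∀ n x f → x * ∑ n f ≈ ∑[ i < n ] (x * f i)
  *-distribˡ-∑ n x = ∑-homo (x *_) (zeroʳ x) (distribˡ x) n

  *-distribʳ-∑ : ∀ n x f → ∑ n f * x ≈ ∑[ i < n ] (f i * x)
  *-distribʳ-∑ n x = ∑-homo (_* x) (zeroˡ x) (λ y z → distribʳ x y z) n

  ·-distrib-∑ : ∀ n c f → c · ∑ n f ≈ ∑[ i < n ] (c · f i)
  ·-distrib-∑ n c = ∑-homo (c ·_) (·-zeroʳ c) (·-distribˡ c) n

  ×-distrib-∑ : ∀ k n f → k × ∑ n f ≈ ∑[ i < n ] (k × f i)
  ×-distrib-∑ k = ∑-homo (k ×_) (×-zeroʳ k) (λ x y → ×-distrib-+ x y k)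

  ∑-*-∑ : ∀ m n f g → ∑ m f * ∑ n g ≈ ∑[ i < m ] ∑[ j < n ] (f i * g j)
  ∑-*-∑ m n f g = trans (*-distribʳ-∑ m (∑ n g) f) (∑-congᵖ m (λ i → *-distribˡ-∑ n (f i) g))

  ×≈fromℕ· : ∀ k x → k × x ≈ fromℕ k · x
  ×≈fromℕ· zero    x = sym (·-zeroˡ x)
  ×≈fromℕ· (suc k) x = begin
    x + k × x                  ≈⟨ +-cong (sym (·-identity x)) (×≈fromℕ· k x) ⟩
    1ℚ · x + fromℕ k · x       ≈⟨ ·-distribʳ 1ℚ (fromℕ k) x ⟨
    (1ℚ ℚ.+ fromℕ k) · x       ≡⟨ ≡.cong (_· x) (1+fromℕ k) ⟩
    fromℕ (suc k) · x          ∎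

  ×-1/suc·-inverse : ∀ n x → suc n × (+ 1 / suc n) · x ≈ x
  ×-1/suc·-inverse n x = begin
    suc n × (+ 1 / suc n) · x                    ≈⟨ ×≈fromℕ· (suc n) _ ⟩
    fromℕ (suc n) · (+ 1 / suc n) · x            ≈⟨ ·-assoc _ _ x ⟨
    (fromℕ (suc n) ℚ.* (+ 1 / suc n)) · x        ≡⟨ ≡.cong (_· x) (fromℕ*1/suc n) ⟩
    1ℚ · x                                       ≈⟨ ·-identity x ⟩
    x                                            ∎

  1/suc·×-inverse : ∀ n x → (+ 1 / suc n) · (suc n × x) ≈ x
  1/suc·×-inverse n x = begin
    (+ 1 / suc n) · (suc n × x)                  ≈⟨ ·-congˡ _ (×≈fromℕ· (suc n) x) ⟩
    (+ 1 / suc n) · fromℕ (suc n) · x            ≈⟨ ·-assoc _ _ x ⟨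
    ((+ 1 / suc n) ℚ.* fromℕ (suc n)) · x        ≡⟨ ≡.cong (_· x) (≡.trans (ℚ.*-comm (+ 1 / suc n) _) (fromℕ*1/suc n)) ⟩
    1ℚ · x                                       ≈⟨ ·-identity x ⟩
    x                                            ∎

  ×-cancel : ∀ n {x y} → suc n × x ≈ suc n × y → x ≈ y
  ×-cancel n {x} {y} eq =
    trans (sym (1/suc·×-inverse n x)) (trans (·-congˡ _ eq) (1/suc·×-inverse n y))

module PowerSeries (A : ℚAlgebra) where

  open import Data.Nat as ℕ using (ℕ; zero; suc; _∸_; _<_; _≤_; s≤s)
  open import Data.Nat.Properties as ℕ
    using (≤-pred; ≤-refl; ≤-trans; m∸n≤m; m∸[m∸n]≡n; m+[n∸m]≡n; ∸-+-assoc; +-∸-assoc; n∸n≡0)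
  open import Data.Rational using (ℚ)
  open import Data.Sum using (inj₁; inj₂)
  open import Level using (0ℓ)
  open import Algebra.Bundles using (CommutativeSemiring)
  open import Algebra.Structures using (IsCommutativeMonoid)
  open import Algebra.Structures.Biased using (isCommutativeSemiringˡ; isCommutativeMonoidˡ)
  import Algebra.Construct.Pointwise ℕ as Pointwise
  open import Relation.Binary.PropositionalEquality as ≡ using (_≡_; _≢_)
  open import Relation.Nullary using (Dec; yes; no)
  open import Data.Empty using (⊥-elim)

  open ℚAlgebraProperties A
  open ≈-Reasoning

  Series : Set
  Series = ℕ → Carrier

  infix  4 _≈ₛ_ _≈[_]_
  infixl 6 _⊕_
  infixl 7 _⊛_
  infixr 8 _·ₛ_

  _≈ₛ_ : Series → Series → Set
  F ≈ₛ G = ∀ n → F n ≈ G n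

  _≈[_]_ : Series → ℕ → Series → Set
  F ≈[ n ] G = ∀ i → i ≤ n → F i ≈ G i

  _⊕_ : Series → Series → Series
  (F ⊕ G) n = F n + G n

  _⊛_ : Series → Series → Series
  (F ⊛ G) n = ∑[ i < suc n ] (F i * G (n ∸ i))

  _·ₛ_ : ℚ → Series → Series
  (c ·ₛ F) n = c · F n

  𝟘 𝟙 : Series
  𝟘 _ = 0#
  𝟙 zero    = 1#
  𝟙 (suc _) = 0#

  ⊛-cong : ∀ {F F′ G G′} → F ≈ₛ F′ → G ≈ₛ G′ → F ⊛ G ≈ₛ F′ ⊛ G′
  ⊛-cong F≈F′ G≈G′ n = ∑-congᵖ (suc n) (λ i → *-cong (F≈F′ i) (G≈G′ (n ∸ i)))

  ⊛-comm : ∀ F G → F ⊛ G ≈ₛ G ⊛ F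
  ⊛-comm F G n = begin
    ∑[ i < suc n ] (F i * G (n ∸ i))                 ≈⟨ ∑-reverse n (λ i → F i * G (n ∸ i)) ⟩
    ∑[ i < suc n ] (F (n ∸ i) * G (n ∸ (n ∸ i)))     ≈⟨ ∑-cong (suc n) swap ⟩
    ∑[ i < suc n ] (G i * F (n ∸ i))                 ∎
    where
    swap : ∀ i → i < suc n → F (n ∸ i) * G (n ∸ (n ∸ i)) ≈ G i * F (n ∸ i)
    swap i i≤n = trans (*-comm _ _) (*-congʳ (reflexive (≡.cong G (m∸[m∸n]≡n (≤-pred i≤n)))))

  ⊛-assoc : ∀ F G K → (F ⊛ G) ⊛ K ≈ₛ F ⊛ (G ⊛ K)
  ⊛-assoc F G K n = begin
    ∑[ a < suc n ] (∑[ i < suc a ] (F i * G (a ∸ i)) * K (n ∸ a))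
      ≈⟨ ∑-congᵖ (suc n) (λ a → *-distribʳ-∑ (suc a) (K (n ∸ a)) (λ i → F i * G (a ∸ i))) ⟩
    ∑[ a < suc n ] ∑[ i < suc a ] (F i * G (a ∸ i) * K (n ∸ a))
      ≈⟨ ∑-cong (suc n) (λ a a≤n → ∑-cong (suc a) (λ i i≤a → regroup a i (≤-pred a≤n) (≤-pred i≤a))) ⟩
    ∑[ a < suc n ] ∑[ i < suc a ] f i (a ∸ i)
      ≈⟨ ∑-antidiagonal n f ⟩
    ∑[ i < suc n ] ∑[ j < suc (n ∸ i) ] (F i * (G j * K (n ∸ i ∸ j)))
      ≈⟨ ∑-congᵖ (suc n) (λ i → *-distribˡ-∑ (suc (n ∸ i)) (F i) (λ j → G j * K (n ∸ i ∸ j))) ⟨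
    ∑[ i < suc n ] (F i * (G ⊛ K) (n ∸ i))
      ∎
    where
    f : ℕ → ℕ → Carrier
    f i j = F i * (G j * K (n ∸ i ∸ j))
    regroup : ∀ a i → a ≤ n → i ≤ a → F i * G (a ∸ i) * K (n ∸ a) ≈ f i (a ∸ i)
    regroup a i a≤n i≤a = trans (*-assoc _ _ _) (*-congˡ (*-congˡ (reflexive (≡.cong K n∸a≡n∸i∸[a∸i]))))
      where
      n∸a≡n∸i∸[a∸i] : n ∸ a ≡ n ∸ i ∸ (a ∸ i)
      n∸a≡n∸i∸[a∸i] = ≡.trans (≡.cong (n ∸_) (≡.sym (m+[n∸m]≡n i≤a))) (≡.sym (∸-+-assoc n i (a ∸ i)))

  ⊛-identityˡ : ∀ F → 𝟙 ⊛ F ≈ₛ F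
  ⊛-identityˡ F n = begin
    1# * F n + ∑[ i < n ] (0# * F (n ∸ suc i))  ≈⟨ +-cong (*-identityˡ _) (∑-zero n (λ i _ → zeroˡ _)) ⟩
    F n + 0#                                    ≈⟨ +-identityʳ _ ⟩
    F n                                         ∎

  ⊛-distribʳ : ∀ F G K → (G ⊕ K) ⊛ F ≈ₛ G ⊛ F ⊕ K ⊛ F
  ⊛-distribʳ F G K n = trans (∑-congᵖ (suc n) (λ i → distribʳ (F (n ∸ i)) (G i) (K i)))
                              (∑-distrib-+ (suc n) (λ i → G i * F (n ∸ i)) (λ i → K i * F (n ∸ i)))

  ⊛-zeroˡ : ∀ F → 𝟘 ⊛ F ≈ₛ 𝟘
  ⊛-zeroˡ F n = ∑-zero (suc n) {λ i → 0# * F (n ∸ i)} (λ i _ → zeroˡ (F (n ∸ i)))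

  ·ₛ-⊛-assoc : ∀ c F G → (c ·ₛ F) ⊛ G ≈ₛ c ·ₛ (F ⊛ G)
  ·ₛ-⊛-assoc c F G n =
    trans (∑-congᵖ (suc n) (λ i → ·-*-assoc c (F i) (G (n ∸ i))))
          (sym (·-distrib-∑ (suc n) c (λ i → F i * G (n ∸ i))))

  ⊛-isCommutativeMonoid : IsCommutativeMonoid _≈ₛ_ _⊛_ 𝟙
  ⊛-isCommutativeMonoid = isCommutativeMonoidˡ record
    { isSemigroup = record
      { isMagma = record { isEquivalence = Pointwise.isEquivalence isEquivalence ; ∙-cong = ⊛-cong }
      ; assoc   = ⊛-assoc
      }
    ; identityˡ = ⊛-identityˡ
    ; comm      = ⊛-comm
    }

  series-commutativeSemiring : CommutativeSemiring 0ℓ 0ℓ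
  series-commutativeSemiring = record
    { isCommutativeSemiring = isCommutativeSemiringˡ record
      { +-isCommutativeMonoid = Pointwise.isCommutativeMonoid +-isCommutativeMonoid
      ; *-isCommutativeMonoid = ⊛-isCommutativeMonoid
      ; distribʳ              = ⊛-distribʳ
      ; zeroˡ                 = ⊛-zeroˡ
      }
    }

  powerSeries : ℚAlgebra
  powerSeries = record
    { commutativeSemiring = series-commutativeSemiring
    ; _·_        = _·ₛ_
    ; ·-congˡ    = λ c F≈G n → ·-congˡ c (F≈G n)
    ; ·-assoc    = λ c d F n → ·-assoc c d (F n)
    ; ·-identity = λ F n → ·-identity (F n)
    ; ·-zeroˡ    = λ F n → ·-zeroˡ (F n)
    ; ·-distribˡ = λ c F G n → ·-distribˡ c (F n) (G n)
    ; ·-distribʳ = λ c d F n → ·-distribʳ c d (F n)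
    ; ·-*-assoc  = ·ₛ-⊛-assoc
    }

  module PS = ℚAlgebraProperties powerSeries
  open import Algebra.Properties.CommutativeSemigroup PS.*-commutativeSemigroup using (x∙yz≈y∙xz)

  ∑-at : ∀ n (F : ℕ → Series) k → PS.∑ n F k ≡ ∑[ i < n ] F i k
  ∑-at zero    F k = ≡.refl
  ∑-at (suc n) F k = ≡.cong (F 0 k +_) (∑-at n (λ i → F (suc i)) k)

  ×-at : ∀ m (F : Series) k → (m PS.× F) k ≡ m × F k
  ×-at zero    F k = ≡.refl
  ×-at (suc m) F k = ≡.cong (F k +_) (×-at m F k)

  ≈[]-suc : ∀ {n F G} → F ≈[ n ] G → F (suc n) ≈ G (suc n) → F ≈[ suc n ] G
  ≈[]-suc {n} F≈G _    i i≤1+n with i ℕ.≟ suc n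
  ... | no  i≢1+n = F≈G i (≤-pred (ℕ.≤∧≢⇒< i≤1+n i≢1+n))
  ≈[]-suc {n} _   Fn≈Gn i _     | yes ≡.refl = Fn≈Gn

  ⊛-≈[] : ∀ n {F F′ G G′} → F ≈[ n ] F′ → G ≈[ n ] G′ → F ⊛ G ≈[ n ] F′ ⊛ G′
  ⊛-≈[] n F≈F′ G≈G′ k k≤n = ∑-cong (suc k) λ i i≤k →
    *-cong (F≈F′ i (≤-trans (≤-pred i≤k) k≤n)) (G≈G′ (k ∸ i) (≤-trans (m∸n≤m k i) k≤n))

  VanishesBelow : ℕ → Series → Set
  VanishesBelow d F = ∀ i → i < d → F i ≈ 0#

  ⊛-vanishesBelow : ∀ a b {F G} → VanishesBelow a F → VanishesBelow b G → VanishesBelow (a ℕ.+ b) (F ⊛ G)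
  ⊛-vanishesBelow a b {F} {G} F≈0 G≈0 n n<a+b = ∑-zero (suc n) {λ i → F i * G (n ∸ i)} term≈0
    where
    term≈0 : ∀ i → i < suc n → F i * G (n ∸ i) ≈ 0#
    term≈0 i i≤n with ℕ.<-≤-connex i a
    ... | inj₁ i<a = trans (*-congʳ (F≈0 i i<a)) (zeroˡ _)
    ... | inj₂ a≤i = trans (*-congˡ (G≈0 (n ∸ i) n∸i<b)) (zeroʳ _)
      where
      n∸i<b : n ∸ i < b
      n∸i<b = ℕ.+-cancelˡ-< i (n ∸ i) b (≡.subst (ℕ._< i ℕ.+ b) (≡.sym (m+[n∸m]≡n (≤-pred i≤n)))
                                        (ℕ.<-≤-trans n<a+b (ℕ.+-monoˡ-≤ b a≤i)))

  D : Series → Series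
  D X k = suc k × X (suc k)

  D-⊛ : ∀ X Y → D (X ⊛ Y) ≈ₛ D X ⊛ Y ⊕ X ⊛ D Y
  D-⊛ X Y n = begin
    suc n × ∑[ i < suc (suc n) ] g i
      ≈⟨ ×-distrib-∑ (suc n) (suc (suc n)) g ⟩
    ∑[ i < suc (suc n) ] (suc n × g i)
      ≈⟨ ∑-cong (suc (suc n)) split ⟩
    ∑[ i < suc (suc n) ] (i × g i + (suc n ∸ i) × g i)
      ≈⟨ ∑-distrib-+ (suc (suc n)) (λ i → i × g i) (λ i → (suc n ∸ i) × g i) ⟩
    ∑[ i < suc (suc n) ] (i × g i) + ∑[ i < suc (suc n) ] ((suc n ∸ i) × g i)
      ≈⟨ +-cong D-left D-right ⟩
    (D X ⊛ Y) n + (X ⊛ D Y) n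
      ∎
    where
    g : ℕ → Carrier
    g i = X i * Y (suc n ∸ i)
    split : ∀ i → i < suc (suc n) → suc n × g i ≈ i × g i + (suc n ∸ i) × g i
    split i i≤1+n = trans (reflexive (≡.cong (_× g i) (≡.sym (m+[n∸m]≡n (≤-pred i≤1+n))))) (×-homo-+ (g i) i (suc n ∸ i))
    D-left : ∑[ i < suc (suc n) ] (i × g i) ≈ (D X ⊛ Y) n
    D-left = trans (+-identityˡ _) (∑-congᵖ (suc n) (λ i → sym (×-assoc-* (suc i) (X (suc i)) (Y (n ∸ i)))))
    D-right : ∑[ i < suc (suc n) ] ((suc n ∸ i) × g i) ≈ (X ⊛ D Y) n
    D-right = begin
      ∑[ i < suc (suc n) ] ((suc n ∸ i) × g i)                   ≈⟨ ∑-init-last (suc n) (λ i → (suc n ∸ i) × g i) ⟩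
      ∑[ i < suc n ] ((suc n ∸ i) × g i) + (n ∸ n) × g (suc n)  ≡⟨ ≡.cong (λ k → ∑ (suc n) term + k × g (suc n)) (n∸n≡0 n) ⟩
      ∑[ i < suc n ] ((suc n ∸ i) × g i) + 0#                   ≈⟨ +-identityʳ _ ⟩
      ∑[ i < suc n ] ((suc n ∸ i) × g i)                        ≈⟨ ∑-cong (suc n) pull ⟩
      ∑[ i < suc n ] (X i * D Y (n ∸ i))                        ∎
      where
      term : ℕ → Carrier
      term i = (suc n ∸ i) × g i
      pull : ∀ i → i < suc n → (suc n ∸ i) × g i ≈ X i * D Y (n ∸ i)
      pull i i≤n rewrite +-∸-assoc 1 (≤-pred i≤n) = sym (×-comm-* (suc (n ∸ i)) (X i) (Y (suc (n ∸ i))))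

  IsLogDerivative : Series → Series → Set
  IsLogDerivative s X = D X ≈ₛ s ⊛ X

  logDerivative-⊛ : ∀ {s t X Y} → IsLogDerivative s X → IsLogDerivative t Y → IsLogDerivative (s ⊕ t) (X ⊛ Y)
  logDerivative-⊛ {s} {t} {X} {Y} DX≈sX DY≈tY n = begin
    D (X ⊛ Y) n                      ≈⟨ D-⊛ X Y n ⟩
    (D X ⊛ Y ⊕ X ⊛ D Y) n            ≈⟨ PS.+-cong (⊛-cong {G = Y} DX≈sX PS.refl) (⊛-cong {X} PS.refl DY≈tY) n ⟩
    (s ⊛ X ⊛ Y ⊕ X ⊛ (t ⊛ Y)) n      ≈⟨ PS.+-cong (⊛-assoc s X Y) (x∙yz≈y∙xz X t Y) n ⟩
    (s ⊛ (X ⊛ Y) ⊕ t ⊛ (X ⊛ Y)) n    ≈⟨ ⊛-distribʳ (X ⊛ Y) s t n ⟨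
    ((s ⊕ t) ⊛ (X ⊛ Y)) n            ∎

  logDerivative-congˡ : ∀ {s t X} → s ≈ₛ t → IsLogDerivative s X → IsLogDerivative t X
  logDerivative-congˡ {X = X} s≈t DX≈sX n = trans (DX≈sX n) (⊛-cong {G = X} s≈t (λ _ → refl) n)

  logDerivative-𝟙 : IsLogDerivative 𝟘 𝟙
  logDerivative-𝟙 n = trans (×-zeroʳ (suc n)) (sym (⊛-zeroˡ 𝟙 n))

  logDerivative-unique : ∀ {s X Y} → IsLogDerivative s X → IsLogDerivative s Y → X 0 ≈ Y 0 → X ≈ₛ Y
  logDerivative-unique {s} {X} {Y} DX≈sX DY≈sY X₀≈Y₀ n = agree n n ≤-refl
    where
    agree : ∀ n → X ≈[ n ] Y
    agree zero    zero    _ = X₀≈Y₀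
    agree (suc n) = ≈[]-suc (agree n) (×-cancel n (begin
      D X n        ≈⟨ DX≈sX n ⟩
      (s ⊛ X) n    ≈⟨ ⊛-≈[] n {s} {s} {X} {Y} (λ _ _ → refl) (agree n) n ≤-refl ⟩
      (s ⊛ Y) n    ≈⟨ DY≈sY n ⟨
      D Y n        ∎))

  monomial : ℕ → Carrier → Series
  monomial j x n with n ℕ.≟ j
  ... | yes _ = x
  ... | no  _ = 0#

  monomial-≡ : ∀ {j n} x → n ≡ j → monomial j x n ≈ x
  monomial-≡ {j} {n} x n≡j with n ℕ.≟ j
  ... | yes _   = refl
  ... | no n≢j = ⊥-elim (n≢j n≡j)

  monomial-≢ : ∀ {j n} x → n ≢ j → monomial j x n ≈ 0#
  monomial-≢ {j} {n} x n≢j with n ℕ.≟ j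
  ... | yes n≡j = ⊥-elim (n≢j n≡j)
  ... | no _    = refl

  monomial-cong : ∀ j {x y} → x ≈ y → monomial j x ≈ₛ monomial j y
  monomial-cong j x≈y n with n ℕ.≟ j
  ... | yes _ = x≈y
  ... | no  _ = refl

  monomial-+ : ∀ j x y → monomial j (x + y) ≈ₛ monomial j x ⊕ monomial j y
  monomial-+ j x y n with n ℕ.≟ j
  ... | yes _ = refl
  ... | no  _ = sym (+-identityˡ 0#)

  monomial-0# : ∀ j → monomial j 0# ≈ₛ 𝟘
  monomial-0# j n with n ℕ.≟ j
  ... | yes _ = refl
  ... | no  _ = refl

  monomial-∑ : ∀ j n (f : ℕ → Carrier) → monomial j (∑ n f) ≈ₛ PS.∑[ i < n ] monomial j (f i)
  monomial-∑ j zero    f = monomial-0# j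
  monomial-∑ j (suc n) f = PS.trans (monomial-+ j _ _) (PS.+-congˡ (monomial-∑ j n (λ i → f (suc i))))

  monomial-× : ∀ j k x → monomial j (k × x) ≈ₛ k PS.× monomial j x
  monomial-× j zero    x = monomial-0# j
  monomial-× j (suc k) x = PS.trans (monomial-+ j _ _) (PS.+-congˡ (monomial-× j k x))

  monomial-⊛ : ∀ a x P n → a ≤ n → (monomial a x ⊛ P) n ≈ x * P (n ∸ a)
  monomial-⊛ a x P n a≤n = begin
    ∑[ i < suc n ] (monomial a x i * P (n ∸ i))   ≈⟨ ∑-single (suc n) a (λ i → monomial a x i * P (n ∸ i)) (s≤s a≤n) others≈0 ⟩
    monomial a x a * P (n ∸ a)                   ≈⟨ *-congʳ (monomial-≡ {a} x ≡.refl) ⟩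
    x * P (n ∸ a)                                ∎
    where
    others≈0 : ∀ i → i < suc n → i ≢ a → monomial a x i * P (n ∸ i) ≈ 0#
    others≈0 i _ i≢a = trans (*-congʳ (monomial-≢ x i≢a)) (zeroˡ _)

  monomial-⊛-< : ∀ a x P n → n < a → (monomial a x ⊛ P) n ≈ 0#
  monomial-⊛-< a x P n n<a = ∑-zero (suc n) {λ i → monomial a x i * P (n ∸ i)} λ i i≤n →
    trans (*-congʳ (monomial-≢ {a} {i} x λ { ≡.refl → ℕ.<-irrefl ≡.refl (ℕ.<-≤-trans i≤n n<a) })) (zeroˡ _)

  monomial-⊛-shift : ∀ a b x P n → a ≤ n → (monomial (a ℕ.+ b) x ⊛ P) n ≈ (monomial b x ⊛ P) (n ∸ a)
  monomial-⊛-shift a b x P n a≤n with ℕ.<-≤-connex (n ∸ a) b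
  ... | inj₁ n∸a<b = trans (monomial-⊛-< (a ℕ.+ b) x P n n<a+b) (sym (monomial-⊛-< b x P (n ∸ a) n∸a<b))
    where
    n<a+b : n < a ℕ.+ b
    n<a+b = ≡.subst (_< a ℕ.+ b) (m+[n∸m]≡n a≤n) (ℕ.+-monoʳ-< a n∸a<b)
  ... | inj₂ b≤n∸a = begin
    (monomial (a ℕ.+ b) x ⊛ P) n      ≈⟨ monomial-⊛ (a ℕ.+ b) x P n a+b≤n ⟩
    x * P (n ∸ (a ℕ.+ b))            ≡⟨ ≡.cong (λ k → x * P k) (∸-+-assoc n a b) ⟨
    x * P (n ∸ a ∸ b)                ≈⟨ monomial-⊛ b x P (n ∸ a) b≤n∸a ⟨
    (monomial b x ⊛ P) (n ∸ a)       ∎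
    where
    a+b≤n : a ℕ.+ b ≤ n
    a+b≤n = ≡.subst (a ℕ.+ b ≤_) (m+[n∸m]≡n a≤n) (ℕ.+-monoʳ-≤ a b≤n∸a)

  monomial-⊛-monomial : ∀ a b x y → monomial a x ⊛ monomial b y ≈ₛ monomial (a ℕ.+ b) (x * y)
  monomial-⊛-monomial a b x y n with ℕ.<-≤-connex n a
  ... | inj₁ n<a = trans (monomial-⊛-< a x (monomial b y) n n<a) (sym (monomial-≢ (x * y) n≢a+b))
    where
    n≢a+b : n ≢ a ℕ.+ b
    n≢a+b ≡.refl = ℕ.<-irrefl ≡.refl (ℕ.<-≤-trans n<a (ℕ.m≤m+n a b))
  ... | inj₂ a≤n = trans (monomial-⊛ a x (monomial b y) n a≤n) (shift (n ∸ a ℕ.≟ b))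
    where
    n≡a+[n∸a] : n ≡ a ℕ.+ (n ∸ a)
    n≡a+[n∸a] = ≡.sym (m+[n∸m]≡n a≤n)
    shift : Dec (n ∸ a ≡ b) → x * monomial b y (n ∸ a) ≈ monomial (a ℕ.+ b) (x * y) n
    shift (yes n∸a≡b) = trans (*-congˡ (monomial-≡ y n∸a≡b))
                              (sym (monomial-≡ (x * y) (≡.trans n≡a+[n∸a] (≡.cong (a ℕ.+_) n∸a≡b))))
    shift (no n∸a≢b)  = trans (*-congˡ (monomial-≢ y n∸a≢b))
                              (trans (zeroʳ x) (sym (monomial-≢ {a ℕ.+ b} {n} (x * y) λ n≡a+b →
                                n∸a≢b (ℕ.+-cancelˡ-≡ a (n ∸ a) b (≡.trans (≡.sym n≡a+[n∸a]) n≡a+b)))))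

  𝟙≈monomial0 : 𝟙 ≈ₛ monomial 0 1#
  𝟙≈monomial0 zero    = refl
  𝟙≈monomial0 (suc n) = refl

module SymmetricFunctionAlgebra where

  open import Data.Nat as ℕ using (ℕ)
  open import Data.Rational as ℚ using (ℚ; 0ℚ; 1ℚ; _+_; _*_)
  import Data.Rational.Properties as ℚ
  open import Data.List using ([]; _∷_; _++_; map)
  import Data.List.Properties as List
  open import Data.Product using (_,_)
  open import Data.Bool using (true; false)
  open import Algebra.Bundles using (CommutativeMonoid)
  open import Algebra.Structures.Biased using (isCommutativeSemiringˡ; isCommutativeMonoidˡ)
  open import Algebra.Properties.CommutativeSemigroup (CommutativeMonoid.commutativeSemigroup ℚ.+-0-commutativeMonoid)
    using (interchange)
  open import Algebra.Properties.CommutativeSemigroup (CommutativeMonoid.commutativeSemigroup ℚ.*-1-commutativeMonoid)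
    using (x∙yz≈y∙xz)
  open import Data.List.Relation.Binary.Permutation.Propositional
    using (_↭_; prep; swap; ↭-refl; ↭-trans; ↭-sym; ↭-reflexive; module PermutationReasoning)
  import Data.List.Relation.Binary.Permutation.Propositional.Properties as ↭
  open import Relation.Binary.Structures using (IsEquivalence)
  open import Relation.Binary.PropositionalEquality
  open ≡-Reasoning
  open import Defs

  insertD-↭ : ∀ a m → insertD a m ↭ a ∷ m
  insertD-↭ a []      = ↭-refl
  insertD-↭ a (b ∷ m) with b ℕ.≤ᵇ a
  ... | true  = ↭-refl
  ... | false = ↭-trans (prep b (insertD-↭ a m)) (swap b a ↭-refl)

  mulMon-↭ : ∀ m n → mulMon m n ↭ m ++ n
  mulMon-↭ []      n = ↭-refl
  mulMon-↭ (a ∷ m) n = ↭-trans (insertD-↭ a (mulMon m n)) (prep a (mulMon-↭ m n))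

  ⟨_∣_⟩ : (Mon → ℚ) → Sym → ℚ
  ⟨ φ ∣ [] ⟩          = 0ℚ
  ⟨ φ ∣ (c , m) ∷ F ⟩ = c * φ m + ⟨ φ ∣ F ⟩

  PermutationInvariant : (Mon → ℚ) → Set
  PermutationInvariant φ = ∀ {m m′} → m ↭ m′ → φ m ≡ φ m′

  -- Equality in ℚ[p₁,p₂,…]: all linear functionals on monomials that ignore the order of the
  -- parts agree.
  infix 4 _≋_
  record _≋_ (F G : Sym) : Set where
    constructor mk≋
    field ⟨⟩-≡ : ∀ φ → PermutationInvariant φ → ⟨ φ ∣ F ⟩ ≡ ⟨ φ ∣ G ⟩
  open _≋_ public

  ⟨⟩-++ : ∀ φ F G → ⟨ φ ∣ F ++ G ⟩ ≡ ⟨ φ ∣ F ⟩ + ⟨ φ ∣ G ⟩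
  ⟨⟩-++ φ []            G = sym (ℚ.+-identityˡ ⟨ φ ∣ G ⟩)
  ⟨⟩-++ φ ((c , m) ∷ F) G = trans (cong (c * φ m +_) (⟨⟩-++ φ F G)) (sym (ℚ.+-assoc (c * φ m) ⟨ φ ∣ F ⟩ ⟨ φ ∣ G ⟩))

  ⟨⟩-relabel : ∀ φ c (g : Mon → Mon) G →
               ⟨ φ ∣ map (λ { (d , n) → (c * d , g n) }) G ⟩ ≡ c * ⟨ (λ n → φ (g n)) ∣ G ⟩
  ⟨⟩-relabel φ c g []            = sym (ℚ.*-zeroʳ c)
  ⟨⟩-relabel φ c g ((d , n) ∷ G) = begin
    c * d * φ (g n) + ⟨ φ ∣ map _ G ⟩                ≡⟨ cong₂ _+_ (ℚ.*-assoc c d (φ (g n))) (⟨⟩-relabel φ c g G) ⟩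
    c * (d * φ (g n)) + c * ⟨ (λ n → φ (g n)) ∣ G ⟩  ≡⟨ ℚ.*-distribˡ-+ c (d * φ (g n)) ⟨ (λ n → φ (g n)) ∣ G ⟩ ⟨
    c * (d * φ (g n) + ⟨ (λ n → φ (g n)) ∣ G ⟩)      ∎

  ⟨⟩-scale : ∀ φ c F → ⟨ φ ∣ scale c F ⟩ ≡ c * ⟨ φ ∣ F ⟩
  ⟨⟩-scale φ c F = ⟨⟩-relabel φ c (λ m → m) F

  ⟨⟩-*S : ∀ φ F G → ⟨ φ ∣ F *S G ⟩ ≡ ⟨ (λ m → ⟨ (λ n → φ (mulMon m n)) ∣ G ⟩) ∣ F ⟩
  ⟨⟩-*S φ []            G = refl
  ⟨⟩-*S φ ((c , m) ∷ F) G =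
    trans (⟨⟩-++ φ (map _ G) (F *S G)) (cong₂ _+_ (⟨⟩-relabel φ c (mulMon m) G) (⟨⟩-*S φ F G))

  ⟨⟩-cong : ∀ {φ ψ} F → (∀ m → φ m ≡ ψ m) → ⟨ φ ∣ F ⟩ ≡ ⟨ ψ ∣ F ⟩
  ⟨⟩-cong []            φ≗ψ = refl
  ⟨⟩-cong ((c , m) ∷ F) φ≗ψ = cong₂ _+_ (cong (c *_) (φ≗ψ m)) (⟨⟩-cong F φ≗ψ)

  ⟨⟩-zero : ∀ F → ⟨ (λ _ → 0ℚ) ∣ F ⟩ ≡ 0ℚ
  ⟨⟩-zero []            = refl
  ⟨⟩-zero ((c , m) ∷ F) = trans (cong₂ _+_ (ℚ.*-zeroʳ c) (⟨⟩-zero F)) (ℚ.+-identityˡ 0ℚ)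

  ⟨⟩-+ : ∀ φ ψ F → ⟨ (λ m → φ m + ψ m) ∣ F ⟩ ≡ ⟨ φ ∣ F ⟩ + ⟨ ψ ∣ F ⟩
  ⟨⟩-+ φ ψ []            = sym (ℚ.+-identityˡ 0ℚ)
  ⟨⟩-+ φ ψ ((c , m) ∷ F) = begin
    c * (φ m + ψ m) + ⟨ (λ m → φ m + ψ m) ∣ F ⟩          ≡⟨ cong₂ _+_ (ℚ.*-distribˡ-+ c (φ m) (ψ m)) (⟨⟩-+ φ ψ F) ⟩
    (c * φ m + c * ψ m) + (⟨ φ ∣ F ⟩ + ⟨ ψ ∣ F ⟩)         ≡⟨ interchange (c * φ m) (c * ψ m) ⟨ φ ∣ F ⟩ ⟨ ψ ∣ F ⟩ ⟩
    (c * φ m + ⟨ φ ∣ F ⟩) + (c * ψ m + ⟨ ψ ∣ F ⟩)         ∎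

  ⟨⟩-* : ∀ c φ F → ⟨ (λ m → c * φ m) ∣ F ⟩ ≡ c * ⟨ φ ∣ F ⟩
  ⟨⟩-* c φ []            = sym (ℚ.*-zeroʳ c)
  ⟨⟩-* c φ ((d , m) ∷ F) = begin
    d * (c * φ m) + ⟨ (λ m → c * φ m) ∣ F ⟩   ≡⟨ cong₂ _+_ (x∙yz≈y∙xz d c (φ m)) (⟨⟩-* c φ F) ⟩
    c * (d * φ m) + c * ⟨ φ ∣ F ⟩             ≡⟨ ℚ.*-distribˡ-+ c (d * φ m) ⟨ φ ∣ F ⟩ ⟨
    c * (d * φ m + ⟨ φ ∣ F ⟩)                 ∎

  ⟨⟩-comm : ∀ (f : Mon → Mon → ℚ) F G →
            ⟨ (λ m → ⟨ f m ∣ G ⟩) ∣ F ⟩ ≡ ⟨ (λ n → ⟨ (λ m → f m n) ∣ F ⟩) ∣ G ⟩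
  ⟨⟩-comm f []            G = sym (⟨⟩-zero G)
  ⟨⟩-comm f ((c , m) ∷ F) G = begin
    c * ⟨ f m ∣ G ⟩ + ⟨ (λ m → ⟨ f m ∣ G ⟩) ∣ F ⟩
      ≡⟨ cong₂ _+_ (sym (⟨⟩-* c (f m) G)) (⟨⟩-comm f F G) ⟩
    ⟨ (λ n → c * f m n) ∣ G ⟩ + ⟨ (λ n → ⟨ (λ m → f m n) ∣ F ⟩) ∣ G ⟩
      ≡⟨ ⟨⟩-+ (λ n → c * f m n) (λ n → ⟨ (λ m → f m n) ∣ F ⟩) G ⟨
    ⟨ (λ n → c * f m n + ⟨ (λ m → f m n) ∣ F ⟩) ∣ G ⟩
      ∎

  invariant-mulMonˡ : ∀ {φ} → PermutationInvariant φ → ∀ n → PermutationInvariant (λ m → φ (mulMon m n))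
  invariant-mulMonˡ inv n m↭m′ =
    inv (↭-trans (mulMon-↭ _ n) (↭-trans (↭.++⁺ʳ n m↭m′) (↭-sym (mulMon-↭ _ n))))

  invariant-mulMonʳ : ∀ {φ} → PermutationInvariant φ → ∀ m → PermutationInvariant (λ n → φ (mulMon m n))
  invariant-mulMonʳ inv m n↭n′ =
    inv (↭-trans (mulMon-↭ m _) (↭-trans (↭.++⁺ˡ m n↭n′) (↭-sym (mulMon-↭ m _))))

  mulMon-comm : ∀ m n → mulMon m n ↭ mulMon n m
  mulMon-comm m n = ↭-trans (mulMon-↭ m n) (↭-trans (↭.++-comm m n) (↭-sym (mulMon-↭ n m)))

  mulMon-assoc : ∀ m n k → mulMon (mulMon m n) k ↭ mulMon m (mulMon n k)
  mulMon-assoc m n k = begin↭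
    mulMon (mulMon m n) k   ↭⟨ mulMon-↭ (mulMon m n) k ⟩
    mulMon m n ++ k         ↭⟨ ↭.++⁺ʳ k (mulMon-↭ m n) ⟩
    (m ++ n) ++ k           ↭⟨ ↭-reflexive (List.++-assoc m n k) ⟩
    m ++ (n ++ k)           ↭⟨ ↭.++⁺ˡ m (mulMon-↭ n k) ⟨
    m ++ mulMon n k         ↭⟨ mulMon-↭ m (mulMon n k) ⟨
    mulMon m (mulMon n k)   ∎↭
    where open PermutationReasoning renaming (begin_ to begin↭_; _∎ to _∎↭)

  invariant-⟨⟩ : ∀ (f : Mon → Mon → ℚ) G → (∀ n → PermutationInvariant (λ m → f m n)) →
                 PermutationInvariant (λ m → ⟨ f m ∣ G ⟩)
  invariant-⟨⟩ f G inv m↭m′ = ⟨⟩-cong G (λ n → inv n m↭m′)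

  ≋-reflexive : ∀ {F G} → F ≡ G → F ≋ G
  ≋-reflexive refl = mk≋ (λ _ _ → refl)

  +S-cong : ∀ {F F′ G G′} → F ≋ F′ → G ≋ G′ → F +S G ≋ F′ +S G′
  +S-cong {F} {F′} {G} {G′} F≋F′ G≋G′ .⟨⟩-≡ φ inv = begin
    ⟨ φ ∣ F ++ G ⟩             ≡⟨ ⟨⟩-++ φ F G ⟩
    ⟨ φ ∣ F ⟩ + ⟨ φ ∣ G ⟩      ≡⟨ cong₂ _+_ (⟨⟩-≡ F≋F′ φ inv) (⟨⟩-≡ G≋G′ φ inv) ⟩
    ⟨ φ ∣ F′ ⟩ + ⟨ φ ∣ G′ ⟩    ≡⟨ ⟨⟩-++ φ F′ G′ ⟨
    ⟨ φ ∣ F′ ++ G′ ⟩           ∎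

  +S-comm : ∀ F G → F +S G ≋ G +S F
  +S-comm F G .⟨⟩-≡ φ _ = trans (⟨⟩-++ φ F G) (trans (ℚ.+-comm ⟨ φ ∣ F ⟩ ⟨ φ ∣ G ⟩) (sym (⟨⟩-++ φ G F)))

  *S-cong : ∀ {F F′ G G′} → F ≋ F′ → G ≋ G′ → F *S G ≋ F′ *S G′
  *S-cong {F} {F′} {G} {G′} F≋F′ G≋G′ .⟨⟩-≡ φ inv = begin
    ⟨ φ ∣ F *S G ⟩
      ≡⟨ ⟨⟩-*S φ F G ⟩
    ⟨ (λ m → ⟨ (λ n → φ (mulMon m n)) ∣ G ⟩) ∣ F ⟩
      ≡⟨ ⟨⟩-≡ F≋F′ _ (invariant-⟨⟩ _ G (invariant-mulMonˡ inv)) ⟩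
    ⟨ (λ m → ⟨ (λ n → φ (mulMon m n)) ∣ G ⟩) ∣ F′ ⟩
      ≡⟨ ⟨⟩-cong F′ (λ m → ⟨⟩-≡ G≋G′ _ (invariant-mulMonʳ inv m)) ⟩
    ⟨ (λ m → ⟨ (λ n → φ (mulMon m n)) ∣ G′ ⟩) ∣ F′ ⟩
      ≡⟨ ⟨⟩-*S φ F′ G′ ⟨
    ⟨ φ ∣ F′ *S G′ ⟩
      ∎

  *S-comm : ∀ F G → F *S G ≋ G *S F
  *S-comm F G .⟨⟩-≡ φ inv = begin
    ⟨ φ ∣ F *S G ⟩
      ≡⟨ ⟨⟩-*S φ F G ⟩
    ⟨ (λ m → ⟨ (λ n → φ (mulMon m n)) ∣ G ⟩) ∣ F ⟩
      ≡⟨ ⟨⟩-comm (λ m n → φ (mulMon m n)) F G ⟩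
    ⟨ (λ n → ⟨ (λ m → φ (mulMon m n)) ∣ F ⟩) ∣ G ⟩
      ≡⟨ ⟨⟩-cong G (λ n → ⟨⟩-cong F (λ m → inv (mulMon-comm m n))) ⟩
    ⟨ (λ n → ⟨ (λ m → φ (mulMon n m)) ∣ F ⟩) ∣ G ⟩
      ≡⟨ ⟨⟩-*S φ G F ⟨
    ⟨ φ ∣ G *S F ⟩
      ∎

  *S-assoc : ∀ F G K → (F *S G) *S K ≋ F *S (G *S K)
  *S-assoc F G K .⟨⟩-≡ φ inv = begin
    ⟨ φ ∣ (F *S G) *S K ⟩
      ≡⟨ ⟨⟩-*S φ (F *S G) K ⟩
    ⟨ ψ ∣ F *S G ⟩
      ≡⟨ ⟨⟩-*S ψ F G ⟩
    ⟨ (λ m → ⟨ (λ n → ψ (mulMon m n)) ∣ G ⟩) ∣ F ⟩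
      ≡⟨ ⟨⟩-cong F (λ m → ⟨⟩-cong G (λ n → ⟨⟩-cong K (λ k → inv (mulMon-assoc m n k)))) ⟩
    ⟨ (λ m → ⟨ (λ n → ⟨ (λ k → φ (mulMon m (mulMon n k))) ∣ K ⟩) ∣ G ⟩) ∣ F ⟩
      ≡⟨ ⟨⟩-cong F (λ m → ⟨⟩-*S (λ q → φ (mulMon m q)) G K) ⟨
    ⟨ (λ m → ⟨ (λ q → φ (mulMon m q)) ∣ G *S K ⟩) ∣ F ⟩
      ≡⟨ ⟨⟩-*S φ F (G *S K) ⟨
    ⟨ φ ∣ F *S (G *S K) ⟩
      ∎
    where
    ψ : Mon → ℚ
    ψ q = ⟨ (λ k → φ (mulMon q k)) ∣ K ⟩

  *S-identityˡ : ∀ F → 1S *S F ≋ F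
  *S-identityˡ F .⟨⟩-≡ φ _ = begin
    ⟨ φ ∣ map _ F ++ [] ⟩                ≡⟨ cong ⟨ φ ∣_⟩ (List.++-identityʳ (map _ F)) ⟩
    ⟨ φ ∣ map _ F ⟩                      ≡⟨ ⟨⟩-relabel φ 1ℚ (mulMon []) F ⟩
    1ℚ * ⟨ φ ∣ F ⟩                       ≡⟨ ℚ.*-identityˡ ⟨ φ ∣ F ⟩ ⟩
    ⟨ φ ∣ F ⟩                            ∎

  *S-distribʳ : ∀ F G K → (G +S K) *S F ≋ (G *S F) +S (K *S F)
  *S-distribʳ F G K = ≋-reflexive (List.concatMap-++ _ G K)

  scale-cong : ∀ c {F G} → F ≋ G → scale c F ≋ scale c G
  scale-cong c {F} {G} F≋G .⟨⟩-≡ φ inv =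
    trans (⟨⟩-scale φ c F) (trans (cong (c *_) (⟨⟩-≡ F≋G φ inv)) (sym (⟨⟩-scale φ c G)))

  scale-*S : ∀ c F G → scale c F *S G ≋ scale c (F *S G)
  scale-*S c F G .⟨⟩-≡ φ _ = begin
    ⟨ φ ∣ scale c F *S G ⟩                                      ≡⟨ ⟨⟩-*S φ (scale c F) G ⟩
    ⟨ (λ m → ⟨ (λ n → φ (mulMon m n)) ∣ G ⟩) ∣ scale c F ⟩      ≡⟨ ⟨⟩-scale _ c F ⟩
    c * ⟨ (λ m → ⟨ (λ n → φ (mulMon m n)) ∣ G ⟩) ∣ F ⟩          ≡⟨ cong (c *_) (⟨⟩-*S φ F G) ⟨
    c * ⟨ φ ∣ F *S G ⟩                                          ≡⟨ ⟨⟩-scale φ c (F *S G) ⟨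
    ⟨ φ ∣ scale c (F *S G) ⟩                                    ∎

  scale-assoc : ∀ c d F → scale (c * d) F ≋ scale c (scale d F)
  scale-assoc c d F .⟨⟩-≡ φ _ = begin
    ⟨ φ ∣ scale (c * d) F ⟩      ≡⟨ ⟨⟩-scale φ (c * d) F ⟩
    c * d * ⟨ φ ∣ F ⟩            ≡⟨ ℚ.*-assoc c d ⟨ φ ∣ F ⟩ ⟩
    c * (d * ⟨ φ ∣ F ⟩)          ≡⟨ cong (c *_) (⟨⟩-scale φ d F) ⟨
    c * ⟨ φ ∣ scale d F ⟩        ≡⟨ ⟨⟩-scale φ c (scale d F) ⟨
    ⟨ φ ∣ scale c (scale d F) ⟩  ∎

  scale-distribʳ : ∀ c d F → scale (c + d) F ≋ scale c F +S scale d F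
  scale-distribʳ c d F .⟨⟩-≡ φ _ = begin
    ⟨ φ ∣ scale (c + d) F ⟩                       ≡⟨ ⟨⟩-scale φ (c + d) F ⟩
    (c + d) * ⟨ φ ∣ F ⟩                           ≡⟨ ℚ.*-distribʳ-+ ⟨ φ ∣ F ⟩ c d ⟩
    c * ⟨ φ ∣ F ⟩ + d * ⟨ φ ∣ F ⟩                 ≡⟨ cong₂ _+_ (⟨⟩-scale φ c F) (⟨⟩-scale φ d F) ⟨
    ⟨ φ ∣ scale c F ⟩ + ⟨ φ ∣ scale d F ⟩         ≡⟨ ⟨⟩-++ φ (scale c F) (scale d F) ⟨
    ⟨ φ ∣ scale c F +S scale d F ⟩                ∎

  symAlgebra : ℚAlgebra
  symAlgebra = record
    { commutativeSemiring = record
      { Carrier = Sym ; _≈_ = _≋_ ; _+_ = _+S_ ; _*_ = _*S_ ; 0# = 0S ; 1# = 1S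
      ; isCommutativeSemiring = isCommutativeSemiringˡ record
        { +-isCommutativeMonoid = isCommutativeMonoidˡ record
          { isSemigroup = record
            { isMagma = record { isEquivalence = ≋-isEquivalence ; ∙-cong = +S-cong }
            ; assoc   = λ F G K → ≋-reflexive (List.++-assoc F G K)
            }
          ; identityˡ = λ F → ≋-reflexive refl
          ; comm      = +S-comm
          }
        ; *-isCommutativeMonoid = isCommutativeMonoidˡ record
          { isSemigroup = record
            { isMagma = record { isEquivalence = ≋-isEquivalence ; ∙-cong = *S-cong }
            ; assoc   = *S-assoc
            }
          ; identityˡ = *S-identityˡ
          ; comm      = *S-comm
          }
        ; distribʳ = *S-distribʳ
        ; zeroˡ    = λ F → ≋-reflexive refl
        }
      }
    ; _·_        = scale
    ; ·-congˡ    = scale-cong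
    ; ·-assoc    = scale-assoc
    ; ·-identity = λ F → mk≋ λ φ _ → trans (⟨⟩-scale φ 1ℚ F) (ℚ.*-identityˡ ⟨ φ ∣ F ⟩)
    ; ·-zeroˡ    = λ F → mk≋ λ φ _ → trans (⟨⟩-scale φ 0ℚ F) (ℚ.*-zeroˡ ⟨ φ ∣ F ⟩)
    ; ·-distribˡ = λ c F G → ≋-reflexive (List.map-++ _ F G)
    ; ·-distribʳ = scale-distribʳ
    ; ·-*-assoc  = scale-*S
    }
    where
    ≋-isEquivalence : IsEquivalence _≋_
    ≋-isEquivalence = record
      { refl  = mk≋ λ _ _ → refl
      ; sym   = λ F≋G → mk≋ λ φ inv → sym (⟨⟩-≡ F≋G φ inv)
      ; trans = λ F≋G G≋K → mk≋ λ φ inv → trans (⟨⟩-≡ F≋G φ inv) (⟨⟩-≡ G≋K φ inv)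
      }

module CompleteHomogeneous where

  open import Data.Nat using (ℕ; zero; suc; _∸_)
  open import Data.Integer using (+_)
  open import Data.Rational using (_/_)
  open import Data.List using ([]; _∷_; map; upTo; applyUpTo; zipWith)
  import Data.List.Properties as List
  open import Relation.Binary.PropositionalEquality
  open import Defs

  hsRev-≡ : ∀ k → hsRev k ≡ map (λ i → h (k ∸ i)) (upTo (suc k))
  hsRev-≡ zero    = refl
  hsRev-≡ (suc k) = cong (h (suc k) ∷_) (begin
    hsRev k                                       ≡⟨ hsRev-≡ k ⟩
    map (λ i → h (k ∸ i)) (upTo (suc k))          ≡⟨ List.map-upTo _ (suc k) ⟩
    applyUpTo (λ i → h (k ∸ i)) (suc k)           ≡⟨ List.map-applyUpTo suc _ (suc k) ⟨
    map (λ i → h (suc k ∸ i)) (applyUpTo suc (suc k)) ∎)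
    where open ≡-Reasoning

  h-newton : ∀ k → h (suc k) ≡ scale (+ 1 / suc k) (sumS (map (λ i → pS (suc i) *S h (k ∸ i)) (upTo (suc k))))
  h-newton k = cong (λ Fs → scale (+ 1 / suc k) (sumS Fs)) (begin
    zipWith pS-times (upTo (suc k)) (hsRev k)                           ≡⟨ cong (zipWith pS-times (upTo (suc k))) (hsRev-≡ k) ⟩
    zipWith pS-times (upTo (suc k)) (map (λ i → h (k ∸ i)) (upTo (suc k))) ≡⟨ zipWith-map (upTo (suc k)) ⟩
    map (λ i → pS (suc i) *S h (k ∸ i)) (upTo (suc k))                   ∎)
    where
    open ≡-Reasoning
    pS-times : ℕ → Sym → Sym
    pS-times i F = pS (suc i) *S F
    zipWith-map : ∀ is → zipWith pS-times is (map (λ i → h (k ∸ i)) is) ≡ map (λ i → pS (suc i) *S h (k ∸ i)) is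
    zipWith-map []       = refl
    zipWith-map (i ∷ is) = cong (_ ∷_) (zipWith-map is)

module Evaluation (R : ℚAlgebra) where

  open import Data.Nat as ℕ using (ℕ; suc; _∸_)
  open import Data.Integer using (+_)
  open import Data.Rational as ℚ using (_/_)
  open import Data.List using ([]; _∷_; _++_; map; foldr; upTo)
  import Data.List.Properties as List
  open import Data.Product using (_,_)
  open import Data.List.Relation.Binary.Permutation.Propositional as ↭ using (_↭_; prep; swap)
  open import Relation.Binary.PropositionalEquality as ≡ using (_≡_)
  open import Defs
  open SymmetricFunctionAlgebra using (mulMon-↭)
  open CompleteHomogeneous using (h-newton)

  open ℚAlgebraProperties R
  open import Algebra.Properties.CommutativeSemigroup *-commutativeSemigroup using (x∙yz≈y∙xz)
  open PowerSeries R using (IsLogDerivative)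
  open ≈-Reasoning

  evalMon : (ℕ → Carrier) → Mon → Carrier
  evalMon a m = foldr _*_ 1# (map a m)

  eval : (ℕ → Carrier) → Sym → Carrier
  eval a []            = 0#
  eval a ((c , m) ∷ F) = c · evalMon a m + eval a F

  module _ (a : ℕ → Carrier) where

    evalMon-++ : ∀ m n → evalMon a (m ++ n) ≈ evalMon a m * evalMon a n
    evalMon-++ []      n = sym (*-identityˡ _)
    evalMon-++ (i ∷ m) n = trans (*-congˡ (evalMon-++ m n)) (sym (*-assoc _ _ _))

    evalMon-↭ : ∀ {m n} → m ↭ n → evalMon a m ≈ evalMon a n
    evalMon-↭ ↭.refl            = refl
    evalMon-↭ (prep i m↭n)      = *-congˡ (evalMon-↭ m↭n)
    evalMon-↭ (swap i j m↭n)    = trans (x∙yz≈y∙xz _ _ _) (*-congˡ (*-congˡ (evalMon-↭ m↭n)))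
    evalMon-↭ (↭.trans m↭n n↭k) = trans (evalMon-↭ m↭n) (evalMon-↭ n↭k)

    evalMon-mulMon : ∀ m n → evalMon a (mulMon m n) ≈ evalMon a m * evalMon a n
    evalMon-mulMon m n = trans (evalMon-↭ (mulMon-↭ m n)) (evalMon-++ m n)

    eval-++ : ∀ F G → eval a (F ++ G) ≈ eval a F + eval a G
    eval-++ []            G = sym (+-identityˡ _)
    eval-++ ((c , m) ∷ F) G = trans (+-congˡ (eval-++ F G)) (sym (+-assoc _ _ _))

    eval-scale : ∀ c F → eval a (scale c F) ≈ c · eval a F
    eval-scale c []            = sym (·-zeroʳ c)
    eval-scale c ((d , m) ∷ F) = begin
      (c ℚ.* d) · evalMon a m + eval a (scale c F)    ≈⟨ +-cong (·-assoc c d _) (eval-scale c F) ⟩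
      c · d · evalMon a m + c · eval a F              ≈⟨ ·-distribˡ c _ _ ⟨
      c · (d · evalMon a m + eval a F)                ∎

    eval-*S : ∀ F G → eval a (F *S G) ≈ eval a F * eval a G
    eval-*S []            G = sym (zeroˡ _)
    eval-*S ((c , m) ∷ F) G = begin
      eval a (map _ G ++ F *S G)                       ≈⟨ eval-++ (map _ G) (F *S G) ⟩
      eval a (map _ G) + eval a (F *S G)               ≈⟨ +-cong (eval-row G) (eval-*S F G) ⟩
      c · evalMon a m * eval a G + eval a F * eval a G ≈⟨ distribʳ _ _ _ ⟨
      (c · evalMon a m + eval a F) * eval a G          ∎
      where
      eval-row : ∀ G → eval a (map (λ { (d , n) → (c ℚ.* d , mulMon m n) }) G) ≈ c · evalMon a m * eval a G
      eval-row []            = sym (zeroʳ _)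
      eval-row ((d , n) ∷ G) = begin
        (c ℚ.* d) · evalMon a (mulMon m n) + eval a (map _ G)         ≈⟨ +-cong (·-congˡ _ (evalMon-mulMon m n)) (eval-row G) ⟩
        (c ℚ.* d) · (evalMon a m * evalMon a n) + c · evalMon a m * eval a G ≈⟨ +-congʳ (·-*-distrib c d _ _) ⟩
        c · evalMon a m * d · evalMon a n + c · evalMon a m * eval a G ≈⟨ distribˡ _ _ _ ⟨
        c · evalMon a m * (d · evalMon a n + eval a G)                ∎

    eval-1S : eval a 1S ≈ 1#
    eval-1S = trans (+-identityʳ _) (·-identity 1#)

    eval-pS : ∀ k → eval a (pS k) ≈ a k
    eval-pS k = trans (+-identityʳ _) (trans (·-identity _) (*-identityʳ (a k)))

    eval-∑ : ∀ n (f : ℕ → Sym) → eval a (sumS (map f (upTo n))) ≈ ∑[ i < n ] eval a (f i)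
    eval-∑ n f = begin
      eval a (sumS (map f (upTo n)))                 ≈⟨ eval-sumS (map f (upTo n)) ⟩
      foldr _+_ 0# (map (eval a) (map f (upTo n)))   ≡⟨ ≡.cong (foldr _+_ 0#) (List.map-∘ (upTo n)) ⟨
      foldr _+_ 0# (map (λ i → eval a (f i)) (upTo n)) ≡⟨ ∑-upTo n (λ i → eval a (f i)) ⟩
      ∑[ i < n ] eval a (f i)                        ∎
      where
      eval-sumS : ∀ Fs → eval a (sumS Fs) ≈ foldr _+_ 0# (map (eval a) Fs)
      eval-sumS []       = refl
      eval-sumS (F ∷ Fs) = trans (eval-++ F (sumS Fs)) (+-congˡ (eval-sumS Fs))

  h-logDerivative : ∀ a → IsLogDerivative (λ i → a (suc i)) (λ k → eval a (h k))
  h-logDerivative a k = begin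
    suc k × eval a (h (suc k))                          ≡⟨ ≡.cong (λ F → suc k × eval a F) (h-newton k) ⟩
    suc k × eval a (scale (+ 1 / suc k) S)              ≈⟨ ×-congʳ (suc k) (eval-scale a _ S) ⟩
    suc k × (+ 1 / suc k) · eval a S                    ≈⟨ ×-1/suc·-inverse k (eval a S) ⟩
    eval a S                                            ≈⟨ eval-∑ a (suc k) (λ i → pS (suc i) *S h (k ∸ i)) ⟩
    ∑[ i < suc k ] eval a (pS (suc i) *S h (k ∸ i))     ≈⟨ ∑-congᵖ (suc k) (λ i → trans (eval-*S a (pS (suc i)) (h (k ∸ i))) (*-congʳ (eval-pS a (suc i)))) ⟩
    ∑[ i < suc k ] (a (suc i) * eval a (h (k ∸ i)))     ∎
    where
    S : Sym
    S = sumS (map (λ i → pS (suc i) *S h (k ∸ i)) (upTo (suc k)))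

module SeriesEvaluation (R : ℚAlgebra) where

  open import Data.Nat using (ℕ)
  open import Data.List using ([]; _∷_)
  open import Data.Product using (_,_)
  open ℚAlgebraProperties R
  open PowerSeries R
  open Evaluation powerSeries

  evalMon-≈[] : ∀ n {a a′ : ℕ → Series} → (∀ i → a i ≈[ n ] a′ i) → ∀ m → evalMon a m ≈[ n ] evalMon a′ m
  evalMon-≈[] n a≈a′ []      t _ = refl
  evalMon-≈[] n a≈a′ (i ∷ m)     = ⊛-≈[] n (a≈a′ i) (evalMon-≈[] n a≈a′ m)

  eval-≈[] : ∀ n {a a′ : ℕ → Series} → (∀ i → a i ≈[ n ] a′ i) → ∀ F → eval a F ≈[ n ] eval a′ F
  eval-≈[] n a≈a′ []            t _   = refl
  eval-≈[] n a≈a′ ((c , m) ∷ F) t t≤n =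
    +-cong (·-congˡ c (evalMon-≈[] n a≈a′ m t t≤n)) (eval-≈[] n a≈a′ F t t≤n)

module Plethysm where

  open import Data.Nat as ℕ using (ℕ; zero; suc; _∸_; _%_; _/_)
  import Data.Nat.Properties as ℕ
  import Data.Nat.DivMod as ℕ
  open import Data.List using ([]; _∷_; _++_; map; foldr)
  import Data.List.Properties as List
  import Data.List.Relation.Binary.Permutation.Propositional.Properties as ↭
  open import Data.Product using (_,_)
  import Data.Rational as ℚ
  open import Data.Bool using (true; false; T)
  open import Data.Unit using (tt)
  open import Function using (_∘_)
  open import Relation.Nullary using (Dec; yes; no)
  open import Relation.Binary.PropositionalEquality as ≡ using (_≡_; _≢_; cong; sym; trans; subst)
  open import Defs

  open SymmetricFunctionAlgebra
  open PowerSeries symAlgebra hiding (Series)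
  private
    module S = ℚAlgebraProperties symAlgebra
    module EvalS = Evaluation symAlgebra

  ⟨⟩-adams : ∀ φ k F → ⟨ φ ∣ adams k F ⟩ ≡ ⟨ (λ m → φ (map (k ℕ.*_) m)) ∣ F ⟩
  ⟨⟩-adams φ k []            = ≡.refl
  ⟨⟩-adams φ k ((c , m) ∷ F) = cong (c ℚ.* φ (map (k ℕ.*_) m) ℚ.+_) (⟨⟩-adams φ k F)

  adams-cong : ∀ k {F G} → F ≋ G → adams k F ≋ adams k G
  adams-cong k {F} {G} F≋G .⟨⟩-≡ φ inv =
    trans (⟨⟩-adams φ k F) (trans (⟨⟩-≡ F≋G _ (inv ∘ ↭.map⁺ (k ℕ.*_))) (sym (⟨⟩-adams φ k G)))

  pleth≡eval : ∀ F b → pleth F b ≡ EvalS.eval (λ i → adams i b) F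
  pleth≡eval []            b = ≡.refl
  pleth≡eval ((c , m) ∷ F) b = cong (_ ++_) (pleth≡eval F b)

  pleth-h0 : ∀ b → pleth (h 0) b ≋ 1S
  pleth-h0 b = S.trans (S.+-identityʳ _) (S.·-identity 1S)

  private
    divisible : ∀ {n k} → (n % suc k ℕ.≡ᵇ 0) ≡ true → n ≡ suc k ℕ.* (n / suc k)
    divisible {n} {k} n%k≡0 = trans (ℕ.m≡m%n+[m/n]*n n (suc k))
      (trans (cong (ℕ._+ (n / suc k) ℕ.* suc k) (ℕ.≡ᵇ⇒≡ _ 0 (subst T (sym n%k≡0) tt))) (ℕ.*-comm (n / suc k) (suc k)))

    indivisible : ∀ {n k} j → (n % suc k ℕ.≡ᵇ 0) ≡ false → n ≢ suc k ℕ.* j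
    indivisible {n} {k} j n%k≢0 ≡.refl =
      subst T n%k≢0 (ℕ.≡⇒≡ᵇ _ 0 (trans (cong (_% suc k) (ℕ.*-comm (suc k) j)) (ℕ.m*n%n≡0 j (suc k))))

  adamsSer-⊕ : ∀ k V W → adamsSer (suc k) (V ⊕ W) ≈ₛ adamsSer (suc k) V ⊕ adamsSer (suc k) W
  adamsSer-⊕ k V W n with n % suc k ℕ.≡ᵇ 0
  ... | true  = S.reflexive (List.map-++ _ (V (n / suc k)) (W (n / suc k)))
  ... | false = S.refl

  adamsSer-vanishesBelow : ∀ k V → V 0 ≋ 0S → VanishesBelow (suc k) (adamsSer (suc k) V)
  adamsSer-vanishesBelow k V V₀≋0 n n<1+k with n % suc k ℕ.≡ᵇ 0
  ... | true  = adams-cong (suc k) (subst (λ i → V i ≋ 0S) (sym (ℕ.m<n⇒m/n≡0 n<1+k)) V₀≋0)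
  ... | false = S.refl

  adamsSer-≈[] : ∀ i n {V V′} → V ≈[ n ] V′ → adamsSer i V ≈[ n ] adamsSer i V′
  adamsSer-≈[] zero    n V≈V′ t t≤n = S.refl
  adamsSer-≈[] (suc k) n V≈V′ t t≤n with t % suc k ℕ.≡ᵇ 0
  ... | true  = adams-cong (suc k) (V≈V′ (t / suc k) (ℕ.≤-trans (ℕ.m/n≤m t (suc k)) t≤n))
  ... | false = S.refl

  adamsSer-monomial : ∀ k j b → adamsSer (suc k) (monomial j b) ≈ₛ monomial (suc k ℕ.* j) (adams (suc k) b)
  adamsSer-monomial k j b n with n % suc k ℕ.≡ᵇ 0 in n%k
  ... | false = S.sym (monomial-≢ {suc k ℕ.* j} {n} _ (indivisible j n%k))
  ... | true  = by-quotient (n / suc k ℕ.≟ j)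
    where
    by-quotient : Dec (n / suc k ≡ j) →
                  adams (suc k) (monomial j b (n / suc k)) ≋ monomial (suc k ℕ.* j) (adams (suc k) b) n
    by-quotient (yes n/k≡j) = S.trans (adams-cong (suc k) (monomial-≡ {j} b n/k≡j))
      (S.sym (monomial-≡ {suc k ℕ.* j} {n} _ (trans (divisible {n} {k} n%k) (cong (suc k ℕ.*_) n/k≡j))))
    by-quotient (no n/k≢j)  = S.trans (adams-cong (suc k) (monomial-≢ {j} b n/k≢j))
      (S.sym (monomial-≢ {suc k ℕ.* j} {n} _ λ n≡k*j →
        n/k≢j (ℕ.*-cancelˡ-≡ (n / suc k) j (suc k) (trans (sym (divisible {n} {k} n%k)) n≡k*j))))

  private
    module EvalSer = Evaluation powerSeries

  foldr-mulSer : ∀ Fs → foldr mulSer oneSer Fs ≈ₛ foldr _⊛_ 𝟙 Fs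
  foldr-mulSer []       zero    = S.refl
  foldr-mulSer []       (suc n) = S.refl
  foldr-mulSer (F ∷ Fs) n = S.trans (S.reflexive (S.∑-upTo (suc n) (λ i → F i *S foldr mulSer oneSer Fs (n ∸ i))))
                                    (⊛-cong {F} (λ _ → S.refl) (foldr-mulSer Fs) n)

  plethSer≈eval : ∀ F V → plethSer F V ≈ₛ EvalSer.eval (λ i → adamsSer i V) F
  plethSer≈eval []            V n = S.refl
  plethSer≈eval ((c , m) ∷ F) V n =
    S.+-cong (S.·-congˡ c (foldr-mulSer (map (λ i → adamsSer i V) m) n)) (plethSer≈eval F V n)

module PlethysticExponential where

  open import Data.Nat as ℕ using (ℕ; suc; _∸_; _<_; _≤_; _%_)
  import Data.Nat.Properties as ℕ
  open import Data.Bool using (true; false)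
  open import Relation.Binary.PropositionalEquality as ≡ using (_≡_; refl; cong; sym; trans; subst)
  open import Data.Nat.Induction using (<-rec)
  open import Defs

  open SymmetricFunctionAlgebra
  open PowerSeries symAlgebra hiding (Series)
  open Plethysm
  open SeriesEvaluation symAlgebra using (eval-≈[])
  private
    module S = ℚAlgebraProperties symAlgebra
    module EvalS = Evaluation symAlgebra
    module SS = PowerSeries powerSeries
    module EvalSer = Evaluation powerSeries

  -- hPleth V k is hₖ[V]. When V has no constant term hₖ[V] starts in degree k
  -- (hPleth-vanishesBelow), so Ω V n is the degree-n part of Ω[V].
  hPleth : Series → ℕ → Series
  hPleth V k = EvalSer.eval (λ i → adamsSer i V) (h k)

  Ω : Series → Series
  Ω V n = S.∑[ k < suc n ] hPleth V k n

  ΩSer≈Ω : ∀ V → ΩSer V ≈ₛ Ω V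
  ΩSer≈Ω V n = S.trans (S.reflexive (S.∑-upTo (suc n) (λ k → plethSer (h k) V n)))
                       (S.∑-congᵖ (suc n) (λ k → plethSer≈eval (h k) V n))

  hPleth-logDerivative : ∀ V → SS.IsLogDerivative (λ i → adamsSer (suc i) V) (hPleth V)
  hPleth-logDerivative V = EvalSer.h-logDerivative (λ i → adamsSer i V)

  hPleth-0 : ∀ V → hPleth V 0 ≈ₛ 𝟙
  hPleth-0 V = EvalSer.eval-1S (λ i → adamsSer i V)

  hPleth-⊕ : ∀ V W → hPleth (V ⊕ W) SS.≈ₛ hPleth V SS.⊛ hPleth W
  hPleth-⊕ V W = SS.logDerivative-unique {s (V ⊕ W)} {hPleth (V ⊕ W)} {hPleth V SS.⊛ hPleth W}
    (hPleth-logDerivative (V ⊕ W))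
    (SS.logDerivative-congˡ {X = hPleth V SS.⊛ hPleth W} (λ i → PS.sym (adamsSer-⊕ i V W))
      (SS.logDerivative-⊛ {s V} {s W} {hPleth V} {hPleth W} (hPleth-logDerivative V) (hPleth-logDerivative W)))
    (λ n → S.sym (constant-term n))
    where
    s : Series → ℕ → Series
    s U i = adamsSer (suc i) U
    constant-term : (hPleth V SS.⊛ hPleth W) 0 ≈ₛ hPleth (V ⊕ W) 0
    constant-term = begin
      hPleth V 0 ⊛ hPleth W 0 ⊕ 𝟘   ≈⟨ PS.+-identityʳ (hPleth V 0 ⊛ hPleth W 0) ⟩
      hPleth V 0 ⊛ hPleth W 0       ≈⟨ ⊛-cong {hPleth V 0} {𝟙} {hPleth W 0} {𝟙} (hPleth-0 V) (hPleth-0 W) ⟩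
      𝟙 ⊛ 𝟙                         ≈⟨ ⊛-identityˡ 𝟙 ⟩
      𝟙                             ≈⟨ hPleth-0 (V ⊕ W) ⟨
      hPleth (V ⊕ W) 0              ∎
      where open PS.≈-Reasoning

  hPleth-vanishesBelow : ∀ V → V 0 ≋ 0S → ∀ k → VanishesBelow k (hPleth V k)
  hPleth-vanishesBelow V V₀≋0 = <-rec _ vanishes
    where
    open S.≈-Reasoning
    vanishes : ∀ k → (∀ {j} → j < k → VanishesBelow j (hPleth V j)) → VanishesBelow k (hPleth V k)
    vanishes (suc k) ih t t<1+k = S.×-cancel k (begin
      suc k S.× hPleth V (suc k) t                                  ≡⟨ ×-at (suc k) (hPleth V (suc k)) t ⟨
      SS.D (hPleth V) k t                                          ≈⟨ hPleth-logDerivative V k t ⟩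
      ((λ i → adamsSer (suc i) V) SS.⊛ hPleth V) k t               ≡⟨ ∑-at (suc k) (λ i → adamsSer (suc i) V ⊛ hPleth V (k ∸ i)) t ⟩
      S.∑[ i < suc k ] (adamsSer (suc i) V ⊛ hPleth V (k ∸ i)) t   ≈⟨ S.∑-zero (suc k) term≈0 ⟩
      0S                                                           ≈⟨ S.×-zeroʳ (suc k) ⟨
      suc k S.× 0S                                                 ∎)
      where
      term≈0 : ∀ i → i < suc k → (adamsSer (suc i) V ⊛ hPleth V (k ∸ i)) t ≋ 0S
      term≈0 i i≤k = ⊛-vanishesBelow (suc i) (k ∸ i) (adamsSer-vanishesBelow i V V₀≋0)
        (ih (ℕ.s≤s (ℕ.m∸n≤m k i))) t (subst (t <_) (sym (cong suc (ℕ.m+[n∸m]≡n (ℕ.≤-pred i≤k)))) t<1+k)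

  Ω-extend : ∀ V → V 0 ≋ 0S → ∀ {n} N → n < N → S.∑[ k < N ] hPleth V k n ≋ Ω V n
  Ω-extend V V₀≋0 {n} N n<N = S.∑-vanishing-tail (suc n) N (λ k → hPleth V k n) n<N
    (λ k n<k _ → hPleth-vanishesBelow V V₀≋0 k n n<k)

  Ω-⊕ : ∀ V W → V 0 ≋ 0S → W 0 ≋ 0S → Ω (V ⊕ W) ≈ₛ Ω V ⊛ Ω W
  Ω-⊕ V W V₀≋0 W₀≋0 n = S.trans expand-left (S.sym expand-right)
    where
    open S.≈-Reasoning
    X Y : ℕ → Series
    X = hPleth V
    Y = hPleth W
    g : ℕ → ℕ → Sym
    g i j = (X i ⊛ Y j) n

    g≋0 : ∀ i j → i ≤ n → n ∸ i < j → g i j ≋ 0S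
    g≋0 i j i≤n n∸i<j = ⊛-vanishesBelow i j (hPleth-vanishesBelow V V₀≋0 i) (hPleth-vanishesBelow W W₀≋0 j) n
      (subst (_< i ℕ.+ j) (ℕ.m+[n∸m]≡n i≤n) (ℕ.+-monoʳ-< i n∸i<j))

    expand-left : Ω (V ⊕ W) n ≋ S.∑[ i < suc n ] S.∑[ j < suc n ] g i j
    expand-left = begin
      S.∑[ k < suc n ] hPleth (V ⊕ W) k n              ≈⟨ S.∑-congᵖ (suc n) (λ k → hPleth-⊕ V W k n) ⟩
      S.∑[ k < suc n ] (X SS.⊛ Y) k n                  ≈⟨ S.∑-congᵖ (suc n) (λ k → S.reflexive (∑-at (suc k) (λ i → X i ⊛ Y (k ∸ i)) n)) ⟩
      S.∑[ k < suc n ] S.∑[ i < suc k ] g i (k ∸ i)    ≈⟨ S.∑-antidiagonal n g ⟩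
      S.∑[ i < suc n ] S.∑[ j < suc (n ∸ i) ] g i j    ≈⟨ S.∑-cong (suc n) extend ⟨
      S.∑[ i < suc n ] S.∑[ j < suc n ] g i j          ∎
      where
      extend : ∀ i → i < suc n → S.∑[ j < suc n ] g i j ≋ S.∑[ j < suc (n ∸ i) ] g i j
      extend i i≤n = S.∑-vanishing-tail (suc (n ∸ i)) (suc n) (g i) (ℕ.s≤s (ℕ.m∸n≤m n i))
        (λ j n∸i<j _ → g≋0 i j (ℕ.≤-pred i≤n) n∸i<j)

    expand-right : (Ω V ⊛ Ω W) n ≋ S.∑[ i < suc n ] S.∑[ j < suc n ] g i j
    expand-right = begin
      S.∑[ a < suc n ] (Ω V a *S Ω W (n ∸ a))
        ≈⟨ S.∑-cong (suc n) (λ a a≤n →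
             S.*-cong (Ω-extend V V₀≋0 (suc n) a≤n) (Ω-extend W W₀≋0 (suc n) (ℕ.s≤s (ℕ.m∸n≤m n a)))) ⟨
      S.∑[ a < suc n ] ((S.∑[ i < suc n ] X i a) *S (S.∑[ j < suc n ] Y j (n ∸ a)))
        ≈⟨ S.∑-congᵖ (suc n) (λ a → S.∑-*-∑ (suc n) (suc n) (λ i → X i a) (λ j → Y j (n ∸ a))) ⟩
      S.∑[ a < suc n ] S.∑[ i < suc n ] S.∑[ j < suc n ] (X i a *S Y j (n ∸ a))
        ≈⟨ S.∑-comm (suc n) (suc n) (λ a i → S.∑[ j < suc n ] (X i a *S Y j (n ∸ a))) ⟩
      S.∑[ i < suc n ] S.∑[ a < suc n ] S.∑[ j < suc n ] (X i a *S Y j (n ∸ a))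
        ≈⟨ S.∑-congᵖ (suc n) (λ i → S.∑-comm (suc n) (suc n) (λ a j → X i a *S Y j (n ∸ a))) ⟩
      S.∑[ i < suc n ] S.∑[ j < suc n ] g i j
        ∎

  Ω-≈[] : ∀ n {V V′} → V ≈[ n ] V′ → Ω V n ≋ Ω V′ n
  Ω-≈[] n V≈V′ = S.∑-congᵖ (suc n) (λ k → eval-≈[] n (λ i → adamsSer-≈[] i n V≈V′) (h k) n ℕ.≤-refl)

  Ω-cong : ∀ {V V′} → V ≈ₛ V′ → Ω V ≈ₛ Ω V′
  Ω-cong V≈V′ n = Ω-≈[] n (λ t _ → V≈V′ t)

  Ω-𝟘 : Ω 𝟘 ≈ₛ 𝟙
  Ω-𝟘 n = S.trans (S.∑-congᵖ (suc n) (λ k → hPleth-𝟘 k n)) (S.trans (S.+-congˡ (S.∑-zero n (λ _ _ → S.refl))) (S.+-identityʳ _))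
    where
    adamsSer-𝟘 : ∀ i → adamsSer (suc i) 𝟘 ≈ₛ 𝟘
    adamsSer-𝟘 i n with n % suc i ℕ.≡ᵇ 0
    ... | true  = S.refl
    ... | false = S.refl
    hPleth-𝟘 : hPleth 𝟘 SS.≈ₛ SS.𝟙
    hPleth-𝟘 = SS.logDerivative-unique {SS.𝟘} {hPleth 𝟘} {SS.𝟙}
      (SS.logDerivative-congˡ {X = hPleth 𝟘} adamsSer-𝟘 (hPleth-logDerivative 𝟘)) SS.logDerivative-𝟙 (hPleth-0 𝟘)

  hPleth-monomial : ∀ j b → hPleth (monomial j b) SS.≈ₛ λ k → monomial (k ℕ.* j) (pleth (h k) b)
  hPleth-monomial j b = SS.logDerivative-unique {s} {hPleth (monomial j b)} {Y}
    (hPleth-logDerivative (monomial j b)) Y-logDerivative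
    (PS.trans (hPleth-0 (monomial j b)) (PS.trans 𝟙≈monomial0 (monomial-cong 0 (S.sym (pleth-h0 b)))))
    where
    s Y : ℕ → Series
    s i = adamsSer (suc i) (monomial j b)
    Y k = monomial (k ℕ.* j) (pleth (h k) b)
    hᵇ : ℕ → Sym
    hᵇ k = EvalS.eval (λ i → adams i b) (h k)

    term : ∀ k i → i ≤ k → monomial (suc k ℕ.* j) (adams (suc i) b *S hᵇ (k ∸ i)) ≈ₛ s i ⊛ Y (k ∸ i)
    term k i i≤k = PS.trans (PS.reflexive (cong (λ d → monomial d (adams (suc i) b *S hᵇ (k ∸ i))) degree))
      (PS.trans (PS.sym (monomial-⊛-monomial (suc i ℕ.* j) ((k ∸ i) ℕ.* j) (adams (suc i) b) (hᵇ (k ∸ i))))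
        (⊛-cong (PS.sym (adamsSer-monomial i j b)) (monomial-cong _ (S.reflexive (sym (pleth≡eval (h (k ∸ i)) b))))))
      where
      degree : suc k ℕ.* j ≡ suc i ℕ.* j ℕ.+ (k ∸ i) ℕ.* j
      degree = trans (cong (λ d → suc d ℕ.* j) (sym (ℕ.m+[n∸m]≡n i≤k))) (ℕ.*-distribʳ-+ j (suc i) (k ∸ i))

    Y-logDerivative : SS.IsLogDerivative s Y
    Y-logDerivative k = begin
      suc k PS.× monomial (suc k ℕ.* j) (pleth (h (suc k)) b)
        ≈⟨ monomial-× (suc k ℕ.* j) (suc k) _ ⟨
      monomial (suc k ℕ.* j) (suc k S.× pleth (h (suc k)) b)
        ≈⟨ monomial-cong _ (S.trans (S.×-congʳ (suc k) (S.reflexive (pleth≡eval (h (suc k)) b))) (EvalS.h-logDerivative (λ i → adams i b) k)) ⟩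
      monomial (suc k ℕ.* j) (S.∑[ i < suc k ] (adams (suc i) b *S hᵇ (k ∸ i)))
        ≈⟨ monomial-∑ (suc k ℕ.* j) (suc k) (λ i → adams (suc i) b *S hᵇ (k ∸ i)) ⟩
      PS.∑[ i < suc k ] monomial (suc k ℕ.* j) (adams (suc i) b *S hᵇ (k ∸ i))
        ≈⟨ PS.∑-cong (suc k) (λ i i≤k → term k i (ℕ.≤-pred i≤k)) ⟩
      PS.∑[ i < suc k ] (s i ⊛ Y (k ∸ i))
        ∎
      where open PS.≈-Reasoning

  Ω-monomial : ∀ j b n → Ω (monomial j b) n ≋ S.∑[ k < suc n ] monomial (k ℕ.* j) (pleth (h k) b) n
  Ω-monomial j b n = S.∑-congᵖ (suc n) (λ k → hPleth-monomial j b k n)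

open SymmetricFunctionAlgebra using (_≋_)

module Partitions where

  open import Data.Nat as ℕ using (ℕ; zero; suc; _∸_; _<_; _≤_; s≤s; _⊓_)
  import Data.Nat.Properties as ℕ
  open import Data.List using (List; []; _∷_; _++_; map; concatMap; upTo; replicate; length; filter; [_])
  import Data.List.Properties as List
  open import Data.List.Relation.Unary.All as All using (All; []; _∷_)
  import Data.List.Relation.Unary.All.Properties as All
  open import Relation.Binary.PropositionalEquality hiding ([_])
  open import Defs

  mult-++ : ∀ j xs ys → mult j (xs ++ ys) ≡ mult j xs ℕ.+ mult j ys
  mult-++ j xs ys = trans (cong length (List.filter-++ (ℕ._≟ j) xs ys)) (List.length-++ (filter (ℕ._≟ j) xs))

  mult-replicate : ∀ j k → mult j (replicate k j) ≡ k
  mult-replicate j k = trans (cong length (List.filter-all (ℕ._≟ j) (All.replicate⁺ k refl))) (List.length-replicate k)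

  mult-replicate-≢ : ∀ j r k → r ≢ j → mult j (replicate k r) ≡ 0
  mult-replicate-≢ j r k r≢j = cong length (List.filter-none (ℕ._≟ j) (All.replicate⁺ k r≢j))

  mult-bounded : ∀ j r ρ → All (_≤ r) ρ → r < j → mult j ρ ≡ 0
  mult-bounded j r ρ ρ≤r r<j = cong length (List.filter-none (ℕ._≟ j)
    (All.map (λ { x≤r refl → ℕ.<-irrefl refl (ℕ.≤-<-trans x≤r r<j) }) ρ≤r))

  partsB-bounded : ∀ f n r → All (All (_≤ r)) (partsB f n r)
  partsB-bounded f       zero    r = [] ∷ []
  partsB-bounded zero    (suc n) r = []
  partsB-bounded (suc f) (suc n) r = All.concat⁺ (All.map⁺ (All.applyUpTo⁺₁ _ (suc n ⊓ r) branch))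
    where
    branch : ∀ {i} → i < suc n ⊓ r → All (All (_≤ r)) (map (suc i ∷_) (partsB f (suc n ∸ suc i) (suc i)))
    branch {i} i<n⊓r = All.map⁺ (All.map (λ ρ≤1+i → 1+i≤r ∷ All.map (λ x≤1+i → ℕ.≤-trans x≤1+i 1+i≤r) ρ≤1+i)
                                         (partsB-bounded f (suc n ∸ suc i) (suc i)))
      where
      1+i≤r : suc i ≤ r
      1+i≤r = ℕ.<-≤-trans i<n⊓r (ℕ.m⊓n≤n (suc n) r)

  partsB-suc : ∀ f n r → r < suc n →
               partsB (suc f) (suc n) (suc r) ≡ partsB (suc f) (suc n) r ++ map (suc r ∷_) (partsB f (suc n ∸ suc r) (suc r))
  partsB-suc f n r (s≤s r≤n) = begin
    concatMap g (upTo (suc n ⊓ suc r))          ≡⟨ cong (λ k → concatMap g (upTo (suc k))) (ℕ.m≥n⇒m⊓n≡n r≤n) ⟩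
    concatMap g (upTo (suc r))                  ≡⟨ cong (concatMap g) (List.upTo-∷ʳ r) ⟨
    concatMap g (upTo r ++ [ r ])               ≡⟨ List.concatMap-++ g (upTo r) [ r ] ⟩
    concatMap g (upTo r) ++ (g r ++ [])         ≡⟨ cong₂ _++_ (cong (λ k → concatMap g (upTo k)) (ℕ.m≥n⇒m⊓n≡n (ℕ.m≤n⇒m≤1+n r≤n)))
                                                              (sym (List.++-identityʳ (g r))) ⟨
    concatMap g (upTo (suc n ⊓ r)) ++ g r       ∎
    where
    open ≡-Reasoning
    g : ℕ → List (List ℕ)
    g i = map (suc i ∷_) (partsB f (suc n ∸ suc i) (suc i))

  replicate-∷ : ∀ {A : Set} k (x : A) xs → replicate k x ++ x ∷ xs ≡ replicate (suc k) x ++ xs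
  replicate-∷ zero    x xs = refl
  replicate-∷ (suc k) x xs = cong (x ∷_) (replicate-∷ k x xs)

  partsB-large : ∀ f n r → n ≤ r → partsB f n (suc r) ≡ partsB f n r
  partsB-large f       zero    r _   = refl
  partsB-large zero    (suc n) r _   = refl
  partsB-large (suc f) (suc n) r n<r =
    cong (λ k → concatMap _ (upTo k)) (trans (ℕ.m≤n⇒m⊓n≡m (ℕ.m≤n⇒m≤1+n n<r)) (sym (ℕ.m≤n⇒m⊓n≡m n<r)))

module PartitionExpansion (V : ℕ → Sym) (V₀≋0 : V 0 ≋ 0S) (N : ℕ) where

  open import Data.Nat as ℕ using (zero; suc; _∸_; _<_; _≤_; z≤n; s≤s)
  import Data.Nat.Properties as ℕ
  open import Data.List using (List; []; _∷_; _++_; map; upTo; replicate)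
  import Data.List.Properties as List
  open import Data.List.Relation.Unary.All as All using (All; []; _∷_)
  open import Data.Sum using (_⊎_; inj₁; inj₂)
  open import Data.Empty using (⊥-elim)
  open import Relation.Nullary using (yes; no)
  open import Relation.Binary.Definitions using (tri<; tri≈; tri>)
  open import Relation.Binary.PropositionalEquality as ≡ using (_≡_; _≢_; refl; cong; sym; trans)
  open import Defs
  open SymmetricFunctionAlgebra
  open PowerSeries symAlgebra hiding (Series)
  open Plethysm
  open PlethysticExponential
  open Partitions
  private
    module S = ℚAlgebraProperties symAlgebra

  factor : List ℕ → ℕ → Sym
  factor ρ i = pleth (h (mult (suc i) ρ)) (V (suc i))

  weight : List ℕ → Sym
  weight ρ = prodS (map (factor ρ) (upTo N))

  factor-absent : ∀ ρ i → mult (suc i) ρ ≡ 0 → factor ρ i ≋ 1S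
  factor-absent ρ i mult≡0 = S.trans (S.reflexive (cong (λ k → pleth (h k) (V (suc i))) mult≡0)) (pleth-h0 (V (suc i)))

  weight-[] : weight [] ≋ 1S
  weight-[] = S.trans (S.reflexive (S.∏-upTo N (factor []))) (S.∏-one N (λ i _ → pleth-h0 (V (suc i))))

  weight-++ : ∀ π ρ → (∀ j → mult j π ≡ 0 ⊎ mult j ρ ≡ 0) → weight (π ++ ρ) ≋ weight π *S weight ρ
  weight-++ π ρ disjoint = begin
    weight (π ++ ρ)                             ≡⟨ S.∏-upTo N (factor (π ++ ρ)) ⟩
    S.∏ N (factor (π ++ ρ))                     ≈⟨ S.∏-cong N (λ i _ → factor-++ i) ⟩
    S.∏ N (λ i → factor π i *S factor ρ i)      ≈⟨ S.∏-distrib-* N (factor π) (factor ρ) ⟩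
    S.∏ N (factor π) *S S.∏ N (factor ρ)        ≡⟨ ≡.cong₂ _*S_ (S.∏-upTo N (factor π)) (S.∏-upTo N (factor ρ)) ⟨
    weight π *S weight ρ                        ∎
    where
    open S.≈-Reasoning
    factor-++ : ∀ i → factor (π ++ ρ) i ≋ factor π i *S factor ρ i
    factor-++ i with disjoint (suc i)
    ... | inj₁ π∌ = begin
      factor (π ++ ρ) i          ≡⟨ cong (λ k → pleth (h k) (V (suc i))) (trans (mult-++ (suc i) π ρ) (cong (ℕ._+ _) π∌)) ⟩
      factor ρ i                 ≈⟨ S.*-identityˡ (factor ρ i) ⟨
      1S *S factor ρ i           ≈⟨ S.*-congʳ {factor ρ i} (factor-absent π i π∌) ⟨
      factor π i *S factor ρ i   ∎
    ... | inj₂ ρ∌ = begin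
      factor (π ++ ρ) i          ≡⟨ cong (λ k → pleth (h k) (V (suc i)))
                                         (trans (mult-++ (suc i) π ρ) (trans (cong (_ ℕ.+_) ρ∌) (ℕ.+-identityʳ _))) ⟩
      factor π i                 ≈⟨ S.*-identityʳ (factor π i) ⟨
      factor π i *S 1S           ≈⟨ S.*-congˡ {factor π i} (factor-absent ρ i ρ∌) ⟨
      factor π i *S factor ρ i   ∎

  weight-replicate : ∀ r k → r < N → weight (replicate k (suc r)) ≋ pleth (h k) (V (suc r))
  weight-replicate r k r<N = begin
    weight (replicate k (suc r))             ≡⟨ S.∏-upTo N (factor (replicate k (suc r))) ⟩
    S.∏ N (factor (replicate k (suc r)))     ≈⟨ S.∏-single N r (factor (replicate k (suc r))) r<N others≈1 ⟩
    factor (replicate k (suc r)) r           ≡⟨ cong (λ l → pleth (h l) (V (suc r))) (mult-replicate (suc r) k) ⟩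
    pleth (h k) (V (suc r))                  ∎
    where
    open S.≈-Reasoning
    others≈1 : ∀ i → i < N → i ≢ r → factor (replicate k (suc r)) i ≋ 1S
    others≈1 i _ i≢r = factor-absent (replicate k (suc r)) i
      (mult-replicate-≢ (suc i) (suc r) k (λ 1+r≡1+i → i≢r (sym (ℕ.suc-injective 1+r≡1+i))))

  truncate : ℕ → ℕ → Sym
  truncate r t with t ℕ.≤? r
  ... | yes _ = V t
  ... | no  _ = 0S

  truncate-≤ : ∀ {r t} → t ≤ r → truncate r t ≋ V t
  truncate-≤ {r} {t} t≤r with t ℕ.≤? r
  ... | yes _   = S.refl
  ... | no t≰r = ⊥-elim (t≰r t≤r)

  truncate-> : ∀ {r t} → r < t → truncate r t ≋ 0S
  truncate-> {r} {t} r<t with t ℕ.≤? r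
  ... | yes t≤r = ⊥-elim (ℕ.<⇒≱ r<t t≤r)
  ... | no _    = S.refl

  truncate-0 : ∀ r → truncate r 0 ≋ 0S
  truncate-0 r = S.trans (truncate-≤ {r} z≤n) V₀≋0

  truncate-zero : truncate 0 ≈ₛ 𝟘
  truncate-zero zero    = truncate-0 0
  truncate-zero (suc t) = truncate-> {0} {suc t} (s≤s z≤n)

  truncate-suc : ∀ r → truncate (suc r) ≈ₛ truncate r ⊕ monomial (suc r) (V (suc r))
  truncate-suc r t with ℕ.<-cmp t (suc r)
  ... | tri< t<1+r t≢1+r _ = S.trans (truncate-≤ {suc r} (ℕ.<⇒≤ t<1+r))
    (S.sym (S.trans (S.+-cong (truncate-≤ {r} (ℕ.≤-pred t<1+r)) (monomial-≢ {suc r} (V (suc r)) t≢1+r))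
                    (S.+-identityʳ (V t))))
  ... | tri≈ _ refl _ = S.trans (truncate-≤ {suc r} ℕ.≤-refl)
    (S.sym (S.trans (S.+-cong (truncate-> {r} ℕ.≤-refl) (monomial-≡ {suc r} (V (suc r)) refl))
                    (S.+-identityˡ (V (suc r)))))
  ... | tri> _ t≢1+r 1+r<t = S.trans (truncate-> {suc r} 1+r<t)
    (S.sym (S.trans (S.+-cong (truncate-> {r} (ℕ.<-trans (ℕ.n<1+n r) 1+r<t)) (monomial-≢ {suc r} (V (suc r)) t≢1+r))
                    (S.+-identityˡ 0S)))

  Ω-truncate-suc : ∀ r → Ω (truncate (suc r)) ≈ₛ Ω (truncate r) ⊛ Ω (monomial (suc r) (V (suc r)))
  Ω-truncate-suc r = PS.trans (Ω-cong (truncate-suc r))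
    (Ω-⊕ (truncate r) (monomial (suc r) (V (suc r))) (truncate-0 r) (monomial-≢ {suc r} {0} (V (suc r)) λ ()))

  sumS-cong : ∀ {g g′ : List ℕ → Sym} xs → All (λ x → g x ≋ g′ x) xs → sumS (map g xs) ≋ sumS (map g′ xs)
  sumS-cong []       []           = S.refl
  sumS-cong (x ∷ xs) (gx≋ ∷ gxs≋) = S.+-cong gx≋ (sumS-cong xs gxs≋)

  *S-distribˡ-sumS : ∀ c (g : List ℕ → Sym) xs → c *S sumS (map g xs) ≋ sumS (map (λ x → c *S g x) xs)
  *S-distribˡ-sumS c g []       = S.zeroʳ c
  *S-distribˡ-sumS c g (x ∷ xs) = S.trans (S.distribˡ c (g x) (sumS (map g xs))) (S.+-congˡ (*S-distribˡ-sumS c g xs))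

  -- The fuel f of partsB is irrelevant once n ≤ f.
  Expansion : ℕ → Set
  Expansion r = ∀ n f → n ≤ f → sumS (map weight (partsB f n r)) ≋ Ω (truncate r) n

  expansion-0 : Expansion 0
  expansion-0 zero    f       _ =
    S.trans (S.+-identityʳ (weight [])) (S.trans weight-[] (S.sym (PS.trans (Ω-cong truncate-zero) Ω-𝟘 0)))
  expansion-0 (suc n) (suc f) _ = S.sym (PS.trans (Ω-cong truncate-zero) Ω-𝟘 (suc n))

  module ExpansionStep (r : ℕ) (r<N : r < N) (expansion-r : Expansion r) where

    P : ℕ → Sym
    P = Ω (truncate r)

    c : ℕ → Sym
    c l = pleth (h l) (V (suc r))

    -- T k n is the degree-n part of (Σₗ hₖ₊ₗ[V_{r+1}] t^{l(r+1)}) · Ω[truncate r].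
    T : ℕ → ℕ → Sym
    T k n = S.∑[ l < suc n ] (monomial (l ℕ.* suc r) (c (k ℕ.+ l)) ⊛ P) n

    weight-prepend : ∀ k {ρ} → All (_≤ r) ρ → weight (replicate k (suc r) ++ ρ) ≋ c k *S weight ρ
    weight-prepend k {ρ} ρ≤r = S.trans (weight-++ (replicate k (suc r)) ρ disjoint) (S.*-congʳ {weight ρ} (weight-replicate r k r<N))
      where
      disjoint : ∀ j → mult j (replicate k (suc r)) ≡ 0 ⊎ mult j ρ ≡ 0
      disjoint j with suc r ℕ.≟ j
      ... | yes refl = inj₂ (mult-bounded (suc r) r ρ ρ≤r ℕ.≤-refl)
      ... | no 1+r≢j = inj₁ (mult-replicate-≢ j (suc r) k 1+r≢j)

    prepend-sum : ∀ k n f → n ≤ f → sumS (map (λ ρ → weight (replicate k (suc r) ++ ρ)) (partsB f n r)) ≋ c k *S P n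
    prepend-sum k n f n≤f = S.trans (sumS-cong (partsB f n r) (All.map (weight-prepend k) (partsB-bounded f n r)))
      (S.trans (S.sym (*S-distribˡ-sumS (c k) weight (partsB f n r))) (S.*-congˡ {c k} (expansion-r n f n≤f)))

    T-head : ∀ k n → (monomial 0 (c (k ℕ.+ 0)) ⊛ P) n ≋ c k *S P n
    T-head k n = S.trans (monomial-⊛ 0 (c (k ℕ.+ 0)) P n z≤n) (S.reflexive (cong (λ l → c l *S P n) (ℕ.+-identityʳ k)))

    T-small : ∀ k n → n < suc r → T k n ≋ c k *S P n
    T-small k n n<1+r = S.trans (S.+-cong (T-head k n) (S.∑-zero n λ l _ →
        monomial-⊛-< (suc l ℕ.* suc r) (c (k ℕ.+ suc l)) P n (ℕ.<-≤-trans n<1+r (ℕ.m≤m+n (suc r) (l ℕ.* suc r)))))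
      (S.+-identityʳ (c k *S P n))

    T-large : ∀ k n → suc r ≤ n → T k n ≋ (c k *S P n) +S T (suc k) (n ∸ suc r)
    T-large k (suc n) 1+r≤1+n = S.+-cong (T-head k (suc n)) (begin
      S.∑[ l < suc n ] (monomial (suc r ℕ.+ l ℕ.* suc r) (c (k ℕ.+ suc l)) ⊛ P) (suc n)
        ≈⟨ S.∑-congᵖ (suc n) shift ⟩
      S.∑[ l < suc n ] (monomial (l ℕ.* suc r) (c (suc k ℕ.+ l)) ⊛ P) (n ∸ r)
        ≈⟨ S.∑-vanishing-tail (suc (n ∸ r)) (suc n) (λ l → (monomial (l ℕ.* suc r) (c (suc k ℕ.+ l)) ⊛ P) (n ∸ r))
                                (s≤s (ℕ.m∸n≤m n r)) beyond ⟩
      T (suc k) (n ∸ r)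
        ∎)
      where
      open S.≈-Reasoning
      shift : ∀ l → (monomial (suc r ℕ.+ l ℕ.* suc r) (c (k ℕ.+ suc l)) ⊛ P) (suc n)
                    ≋ (monomial (l ℕ.* suc r) (c (suc k ℕ.+ l)) ⊛ P) (n ∸ r)
      shift l = S.trans (monomial-⊛-shift (suc r) (l ℕ.* suc r) (c (k ℕ.+ suc l)) P (suc n) 1+r≤1+n)
                        (⊛-cong {G = P} (monomial-cong (l ℕ.* suc r) (S.reflexive (cong c (ℕ.+-suc k l)))) (λ _ → S.refl) (n ∸ r))
      beyond : ∀ l → suc (n ∸ r) ≤ l → l < suc n → (monomial (l ℕ.* suc r) (c (suc k ℕ.+ l)) ⊛ P) (n ∸ r) ≋ 0S
      beyond l n∸r<l _ = monomial-⊛-< (l ℕ.* suc r) (c (suc k ℕ.+ l)) P (n ∸ r) (ℕ.<-≤-trans n∸r<l (ℕ.m≤m*n l (suc r)))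

    prepend-expansion : ∀ f k n → n ≤ f →
                        sumS (map (λ ρ → weight (replicate k (suc r) ++ ρ)) (partsB f n (suc r))) ≋ T k n
    prepend-expansion f       k zero    _ = S.trans (prepend-sum k 0 f z≤n) (S.sym (T-small k 0 (s≤s z≤n)))
    prepend-expansion (suc f) k (suc n) (s≤s n≤f) with r ℕ.<? suc n
    ... | no r≮1+n = begin
      sumS (map wₖ (partsB (suc f) (suc n) (suc r)))  ≡⟨ cong (λ ρs → sumS (map wₖ ρs)) (partsB-large (suc f) (suc n) r (ℕ.≮⇒≥ r≮1+n)) ⟩
      sumS (map wₖ (partsB (suc f) (suc n) r))        ≈⟨ prepend-sum k (suc n) (suc f) (s≤s n≤f) ⟩
      c k *S P (suc n)                                ≈⟨ T-small k (suc n) (s≤s (ℕ.≮⇒≥ r≮1+n)) ⟨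
      T k (suc n)                                     ∎
      where
      open S.≈-Reasoning
      wₖ : List ℕ → Sym
      wₖ ρ = weight (replicate k (suc r) ++ ρ)
    ... | yes r<1+n = begin
      sumS (map wₖ (partsB (suc f) (suc n) (suc r)))
        ≡⟨ cong (λ ρs → sumS (map wₖ ρs)) (partsB-suc f n r r<1+n) ⟩
      sumS (map wₖ (partsB (suc f) (suc n) r ++ map (suc r ∷_) (partsB f (n ∸ r) (suc r))))
        ≡⟨ List.concatMap-++ wₖ (partsB (suc f) (suc n) r) _ ⟩
      sumS (map wₖ (partsB (suc f) (suc n) r)) +S sumS (map wₖ (map (suc r ∷_) (partsB f (n ∸ r) (suc r))))
        ≡⟨ cong (sumS (map wₖ (partsB (suc f) (suc n) r)) +S_) (cong sumS
             (trans (sym (List.map-∘ (partsB f (n ∸ r) (suc r)))) (List.map-cong (λ ρ → cong weight (replicate-∷ k (suc r) ρ)) _))) ⟩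
      sumS (map wₖ (partsB (suc f) (suc n) r)) +S sumS (map (λ ρ → weight (replicate (suc k) (suc r) ++ ρ)) (partsB f (n ∸ r) (suc r)))
        ≈⟨ S.+-cong (prepend-sum k (suc n) (suc f) (s≤s n≤f)) (prepend-expansion f (suc k) (n ∸ r) (ℕ.≤-trans (ℕ.m∸n≤m n r) n≤f)) ⟩
      (c k *S P (suc n)) +S T (suc k) (n ∸ r)
        ≈⟨ T-large k (suc n) r<1+n ⟨
      T k (suc n)
        ∎
      where
      open S.≈-Reasoning
      wₖ : List ℕ → Sym
      wₖ ρ = weight (replicate k (suc r) ++ ρ)

    T-0 : ∀ n → T 0 n ≋ Ω (truncate (suc r)) n
    T-0 n = begin
      S.∑[ l < suc n ] (monomial (l ℕ.* suc r) (c l) ⊛ P) n     ≡⟨ ∑-at (suc n) (λ l → monomial (l ℕ.* suc r) (c l) ⊛ P) n ⟨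
      (PS.∑[ l < suc n ] (monomial (l ℕ.* suc r) (c l) ⊛ P)) n  ≈⟨ PS.*-distribʳ-∑ (suc n) P (λ l → monomial (l ℕ.* suc r) (c l)) n ⟨
      (E′ ⊛ P) n                                                ≈⟨ ⊛-≈[] n {E′} {E} {P} {P} E′≈E (λ _ _ → S.refl) n ℕ.≤-refl ⟩
      (E ⊛ P) n                                                 ≈⟨ ⊛-comm E P n ⟩
      (P ⊛ E) n                                                 ≈⟨ Ω-truncate-suc r n ⟨
      Ω (truncate (suc r)) n                                    ∎
      where
      open S.≈-Reasoning
      E E′ : ℕ → Sym
      E  = Ω (monomial (suc r) (V (suc r)))
      E′ = PS.∑[ l < suc n ] monomial (l ℕ.* suc r) (c l)
      E′≈E : E′ ≈[ n ] E
      E′≈E a a≤n = begin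
        E′ a                                                     ≡⟨ ∑-at (suc n) (λ l → monomial (l ℕ.* suc r) (c l)) a ⟩
        S.∑[ l < suc n ] monomial (l ℕ.* suc r) (c l) a          ≈⟨ S.∑-vanishing-tail (suc a) (suc n) (λ l → monomial (l ℕ.* suc r) (c l) a) (s≤s a≤n)
                                                                      (λ l a<l _ → monomial-≢ {l ℕ.* suc r} {a} (c l) λ { refl → ℕ.<⇒≱ a<l (ℕ.m≤m*n l (suc r)) }) ⟩
        S.∑[ l < suc a ] monomial (l ℕ.* suc r) (c l) a          ≈⟨ Ω-monomial (suc r) (V (suc r)) a ⟨
        E a                                                      ∎

    expansion-suc : Expansion (suc r)
    expansion-suc n f n≤f = S.trans (prepend-expansion f 0 n n≤f) (T-0 n)

  expansion : ∀ r → r ≤ N → Expansion r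
  expansion zero    _   = expansion-0
  expansion (suc r) r<N = ExpansionStep.expansion-suc r r<N (expansion r (ℕ.<⇒≤ r<N))

  Ω-partitions : Ω V N ≋ sumS (map weight (partitions N))
  Ω-partitions = S.trans (Ω-≈[] N (λ t t≤N → S.sym (truncate-≤ {N} t≤N))) (S.sym (expansion N ℕ.≤-refl N N ℕ.≤-refl))

module NormalForm where

  open import Data.Nat as ℕ using (ℕ; zero; suc; _≤_; _∸_; _%_; _/_)
  import Data.Nat.Properties as ℕ
  open import Data.Integer using (+_)
  open import Data.Rational as ℚ using (ℚ; 0ℚ; 1ℚ)
  import Data.Rational.Properties as ℚ
  open import Data.List using ([]; _∷_; map; foldr; upTo; zipWith)
  open import Data.List.Properties using (≡-dec)
  open import Data.List.Relation.Unary.All as All using (All; []; _∷_)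
  import Data.List.Relation.Unary.All.Properties as All
  open import Data.List.Relation.Unary.Linked using (Linked; []; [-]; _∷_)
  open import Data.List.Relation.Binary.Permutation.Propositional using (_↭_; ↭-trans; ↭-sym; ↭⇒↭ₛ′)
  open import Data.List.Relation.Binary.Pointwise using (Pointwise-≡⇒≡)
  open import Relation.Binary.Bundles using (DecTotalOrder; TotalOrder)
  open import Relation.Binary.Properties.DecTotalOrder ℕ.≤-decTotalOrder using (≥-decTotalOrder)
  import Data.List.Sort ≥-decTotalOrder as Descending
  import Data.List.Relation.Unary.Sorted.TotalOrder.Properties as Sorted
  open import Data.Product using (proj₂; _,_)
  open import Data.Bool using (true; false; T; if_then_else_)
  open import Data.Unit using (tt)
  open import Relation.Nullary using (yes; no; does)
  open import Relation.Binary.PropositionalEquality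
  open import Defs
  open SymmetricFunctionAlgebra

  Descending : Mon → Set
  Descending = Linked (λ a b → b ≤ a)

  ↭-descending⇒≡ : ∀ {m m′} → Descending m → Descending m′ → m ↭ m′ → m ≡ m′
  ↭-descending⇒≡ m↘ m′↘ m↭m′ =
    Pointwise-≡⇒≡ (Sorted.↗↭↗⇒≋ ≥-totalOrder m↘ m′↘ (↭⇒↭ₛ′ (TotalOrder.Eq.isEquivalence ≥-totalOrder) m↭m′))
    where
    ≥-totalOrder : TotalOrder _ _ _
    ≥-totalOrder = DecTotalOrder.totalOrder ≥-decTotalOrder

  sort-↭ : ∀ {m m′} → m ↭ m′ → Descending.sort m ≡ Descending.sort m′
  sort-↭ {m} {m′} m↭m′ = ↭-descending⇒≡ (Descending.sort-↗ m) (Descending.sort-↗ m′)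
    (↭-trans (Descending.sort-↭ m) (↭-trans m↭m′ (↭-sym (Descending.sort-↭ m′))))

  sort-descending : ∀ {m} → Descending m → Descending.sort m ≡ m
  sort-descending {m} m↘ = ↭-descending⇒≡ (Descending.sort-↗ m) m↘ (Descending.sort-↭ m)

  -- coeff compares monomials as lists, while _≋_ identifies reorderings of their parts; the two
  -- agree on lists whose monomials are descending, and every construction in Defs keeps them so.
  Normal : Sym → Set
  Normal = All (λ t → Descending (proj₂ t))

  indicator : Mon → Mon → ℚ
  indicator μ m = if does (≡-dec ℕ._≟_ (Descending.sort m) μ) then 1ℚ else 0ℚ

  indicator-invariant : ∀ μ → PermutationInvariant (indicator μ)
  indicator-invariant μ m↭m′ = cong (λ s → if does (≡-dec ℕ._≟_ s μ) then 1ℚ else 0ℚ) (sort-↭ m↭m′)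

  coeff≡⟨indicator⟩ : ∀ F μ → Normal F → coeff F μ ≡ ⟨ indicator μ ∣ F ⟩
  coeff≡⟨indicator⟩ []            μ []          = refl
  coeff≡⟨indicator⟩ ((c , m) ∷ F) μ (m↘ ∷ F↘) rewrite sort-descending m↘ with ≡-dec ℕ._≟_ m μ
  ... | yes _ = cong₂ ℚ._+_ (sym (ℚ.*-identityʳ c)) (coeff≡⟨indicator⟩ F μ F↘)
  ... | no  _ = trans (coeff≡⟨indicator⟩ F μ F↘) (sym (trans (cong (ℚ._+ _) (ℚ.*-zeroʳ c)) (ℚ.+-identityˡ _)))

  ≋⇒≈S : ∀ {F G} → Normal F → Normal G → F ≋ G → F ≈S G
  ≋⇒≈S {F} {G} F↘ G↘ F≋G μ = trans (coeff≡⟨indicator⟩ F μ F↘)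
    (trans (⟨⟩-≡ F≋G (indicator μ) (indicator-invariant μ)) (sym (coeff≡⟨indicator⟩ G μ G↘)))

  private
    ≤ᵇ-true : ∀ {m n} → (m ℕ.≤ᵇ n) ≡ true → m ≤ n
    ≤ᵇ-true {m} {n} m≤ᵇn = ℕ.≤ᵇ⇒≤ m n (subst T (sym m≤ᵇn) tt)

    ≤ᵇ-false : ∀ {m n} → (m ℕ.≤ᵇ n) ≡ false → n ≤ m
    ≤ᵇ-false {m} {n} m≰ᵇn = ℕ.<⇒≤ (ℕ.≰⇒> (λ m≤n → subst T m≰ᵇn (ℕ.≤⇒≤ᵇ m≤n)))

  insertD-under : ∀ a x m → a ≤ x → Descending (x ∷ m) → Descending (x ∷ insertD a m)
  insertD-under a x []      a≤x _              = a≤x ∷ [-]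
  insertD-under a x (b ∷ m) a≤x (b≤x ∷ b∷m↘) with b ℕ.≤ᵇ a in b≤ᵇa
  ... | true  = a≤x ∷ ≤ᵇ-true b≤ᵇa ∷ b∷m↘
  ... | false = b≤x ∷ insertD-under a b m (≤ᵇ-false b≤ᵇa) b∷m↘

  insertD-descending : ∀ a m → Descending m → Descending (insertD a m)
  insertD-descending a []      _    = [-]
  insertD-descending a (b ∷ m) b∷m↘ with b ℕ.≤ᵇ a in b≤ᵇa
  ... | true  = ≤ᵇ-true b≤ᵇa ∷ b∷m↘
  ... | false = insertD-under a b m (≤ᵇ-false b≤ᵇa) b∷m↘

  mulMon-descending : ∀ m n → Descending n → Descending (mulMon m n)
  mulMon-descending []      n n↘ = n↘
  mulMon-descending (a ∷ m) n n↘ = insertD-descending a (mulMon m n) (mulMon-descending m n n↘)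

  *-descending : ∀ k m → Descending m → Descending (map (k ℕ.*_) m)
  *-descending k []          _             = []
  *-descending k (a ∷ [])    _             = [-]
  *-descending k (a ∷ b ∷ m) (b≤a ∷ b∷m↘) = ℕ.*-monoʳ-≤ k b≤a ∷ *-descending k (b ∷ m) b∷m↘

  normal-scale : ∀ c {F} → Normal F → Normal (scale c F)
  normal-scale c = All.map⁺

  normal-*S : ∀ F {G} → Normal G → Normal (F *S G)
  normal-*S []            G↘ = []
  normal-*S ((c , m) ∷ F) G↘ = All.++⁺ (All.map⁺ (All.map (mulMon-descending m _) G↘)) (normal-*S F G↘)

  normal-adams : ∀ k {F} → Normal F → Normal (adams k F)
  normal-adams k F↘ = All.map⁺ (All.map (*-descending k _) F↘)

  normal-sumS : ∀ {Fs} → All Normal Fs → Normal (sumS Fs)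
  normal-sumS = All.concat⁺

  normal-1S : Normal 1S
  normal-1S = [] ∷ []

  normal-prodS : ∀ {Fs} → All Normal Fs → Normal (prodS Fs)
  normal-prodS []           = normal-1S
  normal-prodS {F ∷ _} (_ ∷ Fs↘) = normal-*S F (normal-prodS Fs↘)

  normal-hsRev : ∀ k → All Normal (hsRev k)
  normal-hsRev zero    = normal-1S ∷ []
  normal-hsRev (suc k) = normal-scale (+ 1 ℚ./ suc k) (normal-sumS (zipWith-normal (upTo (suc k)) (normal-hsRev k)))
                       ∷ normal-hsRev k
    where
    zipWith-normal : ∀ is {Hs} → All Normal Hs → All Normal (zipWith (λ i hᵢ → pS (suc i) *S hᵢ) is Hs)
    zipWith-normal []       _          = []
    zipWith-normal (i ∷ is) []         = []
    zipWith-normal (i ∷ is) (H↘ ∷ Hs↘) = normal-*S (pS (suc i)) H↘ ∷ zipWith-normal is Hs↘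

  normal-h : ∀ k → Normal (h k)
  normal-h k with hsRev k | normal-hsRev k
  ... | []    | []     = []
  ... | H ∷ _ | H↘ ∷ _ = H↘

  normal-pleth : ∀ F {b} → Normal b → Normal (pleth F b)
  normal-pleth F b↘ = normal-sumS (All.map⁺ (All.universal (λ (c , m) →
    normal-scale c (normal-prodS (All.map⁺ (All.universal (λ i → normal-adams i b↘) m)))) F))

  NormalSeries : (ℕ → Sym) → Set
  NormalSeries V = ∀ n → Normal (V n)

  normal-mulSer : ∀ F {G} → NormalSeries G → NormalSeries (mulSer F G)
  normal-mulSer F G↘ n = normal-sumS (All.map⁺ (All.universal (λ i → normal-*S (F i) (G↘ (n ∸ i))) (upTo (suc n))))

  normal-foldr-mulSer : ∀ Vs → All NormalSeries Vs → NormalSeries (foldr mulSer oneSer Vs)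
  normal-foldr-mulSer []       []        zero    = normal-1S
  normal-foldr-mulSer []       []        (suc n) = []
  normal-foldr-mulSer (V ∷ Vs) (_ ∷ Vs↘)         = normal-mulSer V (normal-foldr-mulSer Vs Vs↘)

  normal-adamsSer : ∀ i {V} → NormalSeries V → NormalSeries (adamsSer i V)
  normal-adamsSer zero    V↘ n = []
  normal-adamsSer (suc k) V↘ n with n % suc k ℕ.≡ᵇ 0
  ... | true  = normal-adams (suc k) (V↘ (n / suc k))
  ... | false = []

  normal-plethSer : ∀ F {V} → NormalSeries V → NormalSeries (plethSer F V)
  normal-plethSer F {V} V↘ n = normal-sumS (All.map⁺ (All.universal (λ (c , m) →
    normal-scale c (normal-foldr-mulSer (map (λ i → adamsSer i V) m) (All.map⁺ (All.universal (λ i → normal-adamsSer i V↘) m)) n)) F))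

  normal-ΩSer : ∀ {V} → NormalSeries V → NormalSeries (ΩSer V)
  normal-ΩSer V↘ n = normal-sumS (All.map⁺ (All.universal (λ k → normal-plethSer (h k) V↘ n) (upTo (suc n))))

  normal-Ω₀Ser : ∀ {V} → NormalSeries V → NormalSeries (Ω₀Ser V)
  normal-Ω₀Ser V↘ n = normal-sumS (All.map⁺ (All.universal (λ k → normal-plethSer (h (suc k)) V↘ n) (upTo n)))

  normal-Ω₀iter : ∀ m → NormalSeries (Ω₀iter m)
  normal-Ω₀iter zero    n with n ℕ.≡ᵇ 1
  ... | true  = normal-h 1
  ... | false = []
  normal-Ω₀iter (suc m) = normal-Ω₀Ser (normal-Ω₀iter m)

  normal-B : ∀ m n → Normal (B m n)
  normal-B m = normal-ΩSer (normal-Ω₀iter m)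

import Data.List.Properties as List
import Data.List.Relation.Unary.All as All
import Data.List.Relation.Unary.All.Properties as All
open import Relation.Binary.PropositionalEquality using (_≡_; cong; trans; sym)
open SymmetricFunctionAlgebra using (symAlgebra)
open PlethysticExponential using (Ω; ΩSer≈Ω)
open NormalForm

-- In positive degree the extra term h₀[G] = 1 of ΩSer is empty.
Ω₀Ser≡ΩSer : ∀ G j → Ω₀Ser G (suc j) ≡ ΩSer G (suc j)
Ω₀Ser≡ΩSer G j = cong sumS (trans (List.map-upTo _ (suc j)) (sym (List.map-applyUpTo suc _ (suc j))))

mainTheorem2 : ∀ (n m : ℕ) →
    B (suc m) n ≈S
      sumS (map (λ lam → prodS (map (λ i → pleth (h (mult (suc i) lam)) (B m (suc i))) (upTo n)))
                (partitions n))
mainTheorem2 n m = ≋⇒≈S (normal-B (suc m) n) normal-rhs (begin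
  ΩSer H n                            ≈⟨ ΩSer≈Ω H n ⟩
  Ω H n                               ≈⟨ Ω-partitions ⟩
  sumS (map weight (partitions n))    ≡⟨ cong sumS (List.map-cong weight≡ (partitions n)) ⟩
  sumS (map weightᴮ (partitions n))   ∎)
  where
  module S = ℚAlgebraProperties symAlgebra
  H : ℕ → Sym
  H = Ω₀iter (suc m)
  open PartitionExpansion H S.refl n
  open S.≈-Reasoning
  weightᴮ : List ℕ → Sym
  weightᴮ ρ = prodS (map (λ i → pleth (h (mult (suc i) ρ)) (B m (suc i))) (upTo n))
  weight≡ : ∀ ρ → weight ρ ≡ weightᴮ ρ
  weight≡ ρ = cong prodS (List.map-cong (λ i → cong (pleth (h (mult (suc i) ρ))) (Ω₀Ser≡ΩSer (Ω₀iter m) i)) (upTo n))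
  normal-rhs : Normal (sumS (map weightᴮ (partitions n)))
  normal-rhs = normal-sumS (All.map⁺ (All.universal (λ ρ →
    normal-prodS (All.map⁺ (All.universal (λ i → normal-pleth (h (mult (suc i) ρ)) (normal-B m (suc i))) (upTo n)))) (partitions n)))
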